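{- Let $p$ be an odd prime, $\omega=e^{2\pi i/p}$, $K=\mathbb{Q}(\omega)$, $N$ a positive integer, $B(p,N)=\{a_1\omega+\cdots+a_{p-1}\omega^{p-1}: a_i\in\mathbb{Z}\cap[-N,N]\}$ and $\mu=\frac{2}{3}p^3N^2$. Then there is an absolute constant $C$ such that $$R(p,N):=\frac{1}{\#B(p,N)^2}\sum_{\alpha\in B(p,N)}\sum_{\beta\in B(p,N)}\left(d(\alpha,\beta)^2-\mu\right)^2\le C\left(p^5N^4+p^6N^3\right)$$ for all such $p$ and $N$.
   Context: $\operatorname{Tr}_{K/\mathbb{Q}}(\alpha)=\sum_{\sigma\in\operatorname{Gal}(K/\mathbb{Q})}\sigma(\alpha)$. For $\alpha\in K$, $\|\alpha\|=\sqrt{\sum_{j=1}^{p-1}\operatorname{Tr}_{K/\mathbb{Q}}(\alpha\omega^j)^2}$, and $d(\alpha,\beta)=\|\alpha-\beta\|$. -}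

module Defs where

open import Data.Nat as ℕ using (ℕ; zero; suc; _∸_; _+_)
open import Data.Nat.Divisibility using (_∣?_)
open import Data.Nat.Primality using (Prime)
open import Data.Integer as ℤ using (ℤ; +_)
open import Data.Rational as ℚ using (ℚ)
open import Data.Fin using (Fin; toℕ) renaming (zero to fz; suc to fs)
open import Data.List using (List; []; _∷_; map; concatMap; upTo; length; foldr)
open import Relation.Nullary using (yes; no)

sumFin : (n : ℕ) → (Fin n → ℤ) → ℤ
sumFin zero    f = + 0
sumFin (suc n) f = f fz ℤ.+ sumFin n (λ i → f (fs i))

-- An element a₁ω + ⋯ + a_{p-1}ω^{p-1} of Z[ω] ⊂ K = Q(ω), given by its
-- coordinates in the Q-basis ω, …, ω^{p-1} of K; index i : Fin (p-1)
-- holds the coefficient a_{i+1}.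
Elt : ℕ → Set
Elt p = Fin (p ∸ 1) → ℤ

_-ᴱ_ : ∀ {p} → Elt p → Elt p → Elt p
(α -ᴱ β) i = α i ℤ.- β i

-- Tr_{K/Q}(ω^k) = Σ_{t=1}^{p-1} ω^{tk}  (the Galois group is {ω ↦ ω^t}),
-- which equals p-1 if p ∣ k and -1 otherwise.
trPow : (p k : ℕ) → ℤ
trPow p k with p ∣? k
... | yes _ = + (p ∸ 1)
... | no  _ = ℤ.- (+ 1)

-- Tr_{K/Q}(α ω^j) for α = Σ_i a_i ω^i, by Q-linearity of the trace:
-- Σ_i a_i Tr(ω^{i+j}).
trTimesPow : (p : ℕ) → Elt p → ℕ → ℤ
trTimesPow p α j = sumFin (p ∸ 1) (λ i → α i ℤ.* trPow p (suc (toℕ i) ℕ.+ j))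

normSq : (p : ℕ) → Elt p → ℤ
normSq p α = sumFin (p ∸ 1) (λ j → let t = trTimesPow p α (suc (toℕ j)) in t ℤ.* t)

distSq : (p : ℕ) → Elt p → Elt p → ℤ
distSq p α β = normSq p (_-ᴱ_ {p} α β)

range : ℕ → List ℤ
range N = map (λ i → + i ℤ.- + N) (upTo (suc (2 ℕ.* N)))

box : (m N : ℕ) → List (Fin m → ℤ)
box zero    N = (λ ()) ∷ []
box (suc m) N = concatMap (λ x → map (λ v → cons x v) (box m N)) (range N)
  where
  cons : ℤ → (Fin m → ℤ) → Fin (suc m) → ℤ
  cons x v fz     = x
  cons x v (fs i) = v i

-- B(p,N), enumerated via coefficient vectors (the coordinate map is a
-- bijection onto B(p,N) since ω,…,ω^{p-1} is a Q-basis of K).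
B : (p N : ℕ) → List (Elt p)
B p N = box (p ∸ 1) N

toℚ : ℤ → ℚ
toℚ z = z ℚ./ 1

sumℚ : List ℚ → ℚ
sumℚ = foldr ℚ._+_ ℚ.0ℚ

-- 1/n for n ≥ 1 (and 0 for n = 0, never used since #B ≥ 1)
invℕ : ℕ → ℚ
invℕ zero    = ℚ.0ℚ
invℕ (suc n) = (+ 1) ℚ./ (suc n)

μ : ℕ → ℕ → ℚ
μ p N = ((+ 2) ℚ./ 3) ℚ.* toℚ (+ (p ℕ.^ 3 ℕ.* N ℕ.^ 2))

R : ℕ → ℕ → ℚ
R p N = invℕ (length (B p N) ℕ.* length (B p N)) ℚ.*
  sumℚ (concatMap (λ α → map (λ β →
     let x = toℚ (distSq p α β) ℚ.- μ p N in x ℚ.* x) (B p N)) (B p N))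

{-# OPTIONS --safe #-}
-- Write the difference of two points of the box as c = α - β. In the coordinates ω, …, ω^(p-1) the
-- trace form is d(α, β)² = p² Q(c) - (p + 1) S(c)², where Q(c) is the sum of the squares and S(c) the
-- sum of the coordinates of c. Over all pairs (α, β) the coordinates of c are independent copies of the
-- difference t of two uniform points of [-N, N]; the odd moments of t vanish and E[t²], E[t⁴] follow from
-- Faulhaber's formulas. The moments E[Q], E[S²], E[Q²], E[Q S²] and E[S⁴] satisfy first order recurrences
-- in the dimension, which evaluate R(p, N) exactly as a polynomial. The leading terms p⁶ N⁴ cancel, and
-- 50 (p⁵ N⁴ + p⁶ N³) - 45 R(p, N) has nonnegative coefficients as a polynomial in p - 1 and N - 1.
module Submission where

open import Defs
open import Algebra.Bundles.Raw using (RawRing)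
open import Data.Integer as ℤ using (ℤ; +_; 0ℤ; 1ℤ)
open import Data.List using (List; []; _∷_; _++_; _∷ʳ_; map; concatMap; upTo; length)
open import Data.Nat as ℕ using (ℕ; zero; suc; _∸_)
open import Level using (0ℓ)

-- Written over an arbitrary raw ring with integer constants ι, so that each polynomial serves both as a
-- function on ℤ and as input to the ring solver.
module Polynomials (R : RawRing 0ℓ 0ℓ) (ι : ℤ → RawRing.Carrier R) where

  open RawRing R

  private
    infixl 6 _-_
    infixr 8 _^_
    _-_ : Carrier → Carrier → Carrier
    x - y = x + - y
    _^_ : Carrier → ℕ → Carrier
    x ^ zero  = 1#
    x ^ suc n = x * x ^ n

  -- For the difference t of two coordinates in [-N, N]: α₂ N = 3 E[t²] and α₄ N = 15 E[t⁴]
  α₂ α₄ : Carrier → Carrier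
  α₂ N = ι (+ 2) * N * (N + 1#)
  α₄ N = α₂ N * (ι (+ 4) * α₂ N - 1#)

  -- 45 R(p, N) = 5 E[(3 d² - 2 p³ N²)²], in terms of 45 E[Q²] = 45 E[Q S²], 45 E[S⁴] and 3 E[Q] = 3 E[S²]
  R×45 : Carrier → Carrier → Carrier
  R×45 P N =
    let m   = P - 1#
        k   = P ^ 3 * N ^ 2
        a   = α₂ N
        b   = α₄ N
        EQ² = ι (+ 3) * m * b + ι (+ 5) * m * (m - 1#) * a * a
        ES⁴ = ι (+ 3) * m * b + ι (+ 15) * m * (m - 1#) * a * a
        EQ  = m * a
    in P * P * (P * P) * EQ² + (P + 1#) * (P + 1#) * ES⁴ - ι (+ 2) * (P * P * (P + 1#)) * EQ²
       + ι (+ 20) * (k * k) - ι (+ 20) * (P * P * k) * EQ + ι (+ 20) * ((P + 1#) * k) * EQ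

  bound : Carrier → Carrier → Carrier
  bound P N = P ^ 5 * N ^ 4 + P ^ 6 * N ^ 3

  horner : List ℕ → Carrier → Carrier
  horner []       x = 0#
  horner (c ∷ cs) x = ι (+ c) + x * horner cs x

  horner₂ : List (List ℕ) → Carrier → Carrier → Carrier
  horner₂ []         x y = 0#
  horner₂ (cs ∷ css) x y = horner cs y + x * horner₂ css x y

open Polynomials ℤ.+-*-rawRing (λ z → z)

open import Data.Bool using (if_then_else_)
open import Data.Fin as Fin using (Fin; toℕ; opposite) renaming (zero to fz; suc to fs)
import Data.Fin.Properties as Fin
open import Data.Empty using (⊥-elim)
open import Data.Nat.Divisibility using (_∣_; divides; _∣?_; ∣-refl)
open import Data.Nat.Primality using (Prime; prime⇒nonZero)
import Algebra.Properties.Semiring.Sum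
import Data.Fin.Permutation as Perm
open import Data.Integer using (-1ℤ; _+_; _*_; _-_; -_; _^_; _≤_)
import Data.Integer.Properties as ℤ
open import Data.Integer.Tactic.RingSolver using (solve-∀)
import Data.Integer.Solver as ℤ-Solver
import Data.List.Properties as List
import Data.Nat.Properties as ℕ
open import Data.Product using (_×_; _,_; proj₁; proj₂; ∃)
open import Data.Rational as ℚ using (ℚ)
import Data.Rational.Properties as ℚ
open import Data.Rational.Unnormalised as ℚᵘ using (ℚᵘ; mkℚᵘ)
import Data.Rational.Unnormalised.Properties as ℚᵘ
open import Data.Vec.Functional using (head; tail)
open import Function using (_∘_; const)
import Tactic.RingSolver as RingSolver
import Tactic.RingSolver.Core.AlmostCommutativeRing as ACR
open import Relation.Nullary using (Dec; does; yes; no)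
open import Relation.Nullary.Decidable using (dec⇒maybe)
open import Relation.Binary.PropositionalEquality using (_≡_; _≢_; refl; sym; trans; cong; cong₂; subst; subst₂; module ≡-Reasoning)
open ≡-Reasoning

module _ {A : Set} where

  ∑ : List A → (A → ℤ) → ℤ
  ∑ []       f = 0ℤ
  ∑ (x ∷ xs) f = f x + ∑ xs f

  infixr 6.5 ∑
  syntax ∑ xs (λ x → e) = ∑[ x ∈ xs ] e

  ∑-cong : ∀ xs {f g : A → ℤ} → (∀ x → f x ≡ g x) → ∑ xs f ≡ ∑ xs g
  ∑-cong []       f≗g = refl
  ∑-cong (x ∷ xs) f≗g = cong₂ _+_ (f≗g x) (∑-cong xs f≗g)

  ∑-zero : ∀ xs → ∑[ x ∈ xs ] 0ℤ ≡ 0ℤ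
  ∑-zero []       = refl
  ∑-zero (x ∷ xs) = trans (ℤ.+-identityˡ (∑[ x ∈ xs ] 0ℤ)) (∑-zero xs)

  ∑-+ : ∀ xs (f g : A → ℤ) → ∑[ x ∈ xs ] (f x + g x) ≡ ∑ xs f + ∑ xs g
  ∑-+ []       f g = refl
  ∑-+ (x ∷ xs) f g = begin
    f x + g x + ∑[ x ∈ xs ] (f x + g x) ≡⟨ cong (_+_ (f x + g x)) (∑-+ xs f g) ⟩
    f x + g x + (∑ xs f + ∑ xs g)       ≡⟨ interchange (f x) (g x) (∑ xs f) (∑ xs g) ⟩
    f x + ∑ xs f + (g x + ∑ xs g)       ∎
    where
    interchange : ∀ a b c d → a + b + (c + d) ≡ a + c + (b + d)
    interchange = solve-∀

  ∑-*ˡ : ∀ xs k (f : A → ℤ) → ∑[ x ∈ xs ] (k * f x) ≡ k * ∑ xs f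
  ∑-*ˡ []       k f = sym (ℤ.*-zeroʳ k)
  ∑-*ˡ (x ∷ xs) k f = trans (cong (_+_ (k * f x)) (∑-*ˡ xs k f)) (sym (ℤ.*-distribˡ-+ k (f x) (∑ xs f)))

  ∑-*ʳ : ∀ xs k (f : A → ℤ) → ∑[ x ∈ xs ] (f x * k) ≡ ∑ xs f * k
  ∑-*ʳ xs k f = begin
    ∑[ x ∈ xs ] (f x * k) ≡⟨ ∑-cong xs (λ x → ℤ.*-comm (f x) k) ⟩
    ∑[ x ∈ xs ] (k * f x) ≡⟨ ∑-*ˡ xs k f ⟩
    k * ∑ xs f            ≡⟨ ℤ.*-comm k (∑ xs f) ⟩
    ∑ xs f * k            ∎

  ∑-const : ∀ xs k → ∑[ x ∈ xs ] k ≡ + length xs * k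
  ∑-const []       k = refl
  ∑-const (x ∷ xs) k = begin
    k + ∑[ x ∈ xs ] k        ≡⟨ cong (_+_ k) (∑-const xs k) ⟩
    k + + length xs * k      ≡⟨ sym (ℤ.suc-* (+ length xs) k) ⟩
    + suc (length xs) * k    ∎

  ∑-++ : ∀ xs ys (f : A → ℤ) → ∑ (xs ++ ys) f ≡ ∑ xs f + ∑ ys f
  ∑-++ []       ys f = sym (ℤ.+-identityˡ (∑ ys f))
  ∑-++ (x ∷ xs) ys f = trans (cong (_+_ (f x)) (∑-++ xs ys f)) (sym (ℤ.+-assoc (f x) (∑ xs f) (∑ ys f)))

module _ {A B : Set} where

  ∑-map : ∀ (g : A → B) xs (f : B → ℤ) → ∑ (map g xs) f ≡ ∑[ x ∈ xs ] f (g x)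
  ∑-map g []       f = refl
  ∑-map g (x ∷ xs) f = cong (_+_ (f (g x))) (∑-map g xs f)

  ∑-concatMap : ∀ (g : A → List B) xs (f : B → ℤ) → ∑ (concatMap g xs) f ≡ ∑[ x ∈ xs ] ∑ (g x) f
  ∑-concatMap g []       f = refl
  ∑-concatMap g (x ∷ xs) f = trans (∑-++ (g x) (concatMap g xs) f) (cong (_+_ (∑ (g x) f)) (∑-concatMap g xs f))

  ∑-comm : ∀ xs ys (f : A → B → ℤ) → ∑[ x ∈ xs ] ∑[ y ∈ ys ] f x y ≡ ∑[ y ∈ ys ] ∑[ x ∈ xs ] f x y
  ∑-comm []       ys f = sym (∑-zero ys)
  ∑-comm (x ∷ xs) ys f = begin
    ∑ ys (f x) + ∑[ x ∈ xs ] ∑[ y ∈ ys ] f x y ≡⟨ cong (_+_ (∑ ys (f x))) (∑-comm xs ys f) ⟩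
    ∑ ys (f x) + ∑[ y ∈ ys ] ∑[ x ∈ xs ] f x y ≡⟨ sym (∑-+ ys (f x) (λ y → ∑[ x ∈ xs ] f x y)) ⟩
    ∑[ y ∈ ys ] (f x y + ∑[ x ∈ xs ] f x y)   ∎

  ∑-product : ∀ xs ys (f : A → ℤ) (g : B → ℤ) → ∑[ x ∈ xs ] ∑[ y ∈ ys ] f x * g y ≡ ∑ xs f * ∑ ys g
  ∑-product xs ys f g = trans (∑-cong xs (λ x → ∑-*ˡ ys (f x) g)) (∑-*ʳ xs (∑ ys g) f)

∑-concatMap-map : ∀ {A B C : Set} xs ys (k : A → B → C) (f : C → ℤ) →
  ∑ (concatMap (λ x → map (k x) ys) xs) f ≡ ∑[ x ∈ xs ] ∑[ y ∈ ys ] f (k x y)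
∑-concatMap-map xs ys k f = trans (∑-concatMap (λ x → map (k x) ys) xs f) (∑-cong xs (λ x → ∑-map (k x) ys f))

∑-neg : ∀ {A : Set} xs (f : A → ℤ) → ∑[ x ∈ xs ] - f x ≡ - ∑ xs f
∑-neg xs f = begin
  ∑[ x ∈ xs ] - f x       ≡⟨ ∑-cong xs (λ x → sym (ℤ.-1*i≡-i (f x))) ⟩
  ∑[ x ∈ xs ] -1ℤ * f x   ≡⟨ ∑-*ˡ xs -1ℤ f ⟩
  -1ℤ * ∑ xs f            ≡⟨ ℤ.-1*i≡-i (∑ xs f) ⟩
  - ∑ xs f                ∎

module _ {A B T : Set} where

  ∑-separable : ∀ xs ys (ts : List T) (u : T → A → ℤ) (v : T → B → ℤ) →
    ∑[ x ∈ xs ] ∑[ y ∈ ys ] ∑[ t ∈ ts ] u t x * v t y ≡ ∑[ t ∈ ts ] ∑ xs (u t) * ∑ ys (v t)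
  ∑-separable xs ys ts u v = begin
    ∑[ x ∈ xs ] ∑[ y ∈ ys ] ∑[ t ∈ ts ] u t x * v t y ≡⟨ ∑-cong xs (λ x → ∑-comm ys ts (λ y t → u t x * v t y)) ⟩
    ∑[ x ∈ xs ] ∑[ t ∈ ts ] ∑[ y ∈ ys ] u t x * v t y ≡⟨ ∑-comm xs ts (λ x t → ∑[ y ∈ ys ] u t x * v t y) ⟩
    ∑[ t ∈ ts ] ∑[ x ∈ xs ] ∑[ y ∈ ys ] u t x * v t y ≡⟨ ∑-cong ts (λ t → ∑-product xs ys (u t) (v t)) ⟩
    ∑[ t ∈ ts ] ∑ xs (u t) * ∑ ys (v t)               ∎

∑-upTo-telescope : ∀ (F f : ℤ → ℤ) → (∀ x → F (1ℤ + x) - F x ≡ f x) → F 0ℤ ≡ 0ℤ →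
  ∀ n → ∑[ i ∈ upTo n ] f (+ i) ≡ F (+ n)
∑-upTo-telescope F f ΔF≡f F0≡0 zero    = sym F0≡0
∑-upTo-telescope F f ΔF≡f F0≡0 (suc n) = begin
  ∑[ i ∈ upTo (suc n) ] f (+ i)               ≡⟨ cong (λ is → ∑[ i ∈ is ] f (+ i)) (List.upTo-∷ʳ n) ⟨
  ∑[ i ∈ upTo n ∷ʳ n ] f (+ i)                ≡⟨ ∑-++ (upTo n) (n ∷ []) (λ i → f (+ i)) ⟩
  ∑[ i ∈ upTo n ] f (+ i) + (f (+ n) + 0ℤ)
    ≡⟨ cong₂ (λ s t → s + (t + 0ℤ)) (∑-upTo-telescope F f ΔF≡f F0≡0 n) (sym (ΔF≡f (+ n))) ⟩
  F (+ n) + (F (1ℤ + + n) - F (+ n) + 0ℤ)     ≡⟨ cancel (F (+ n)) (F (1ℤ + + n)) ⟩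
  F (1ℤ + + n)                                ∎
  where
  cancel : ∀ a b → a + (b - a + 0ℤ) ≡ b
  cancel = solve-∀

-- Traces in coordinates

squareSum : (m : ℕ) → (Fin m → ℤ) → ℤ
squareSum m c = sumFin m (λ i → c i * c i)

coordSum : (m : ℕ) → (Fin m → ℤ) → ℤ
coordSum m c = sumFin m c

[_] : ∀ {A : Set} → Dec A → ℤ
[ a? ] = if does a? then 1ℤ else 0ℤ

open Algebra.Properties.Semiring.Sum ℤ.+-*-semiring using (sum; sum-cong-≗; ∑-distrib-+; *-distribˡ-sum; ∑-permute)

sumFin≡sum : ∀ n (f : Fin n → ℤ) → sumFin n f ≡ sum f
sumFin≡sum zero    f = refl
sumFin≡sum (suc n) f = cong (_+_ (f fz)) (sumFin≡sum n (f ∘ fs))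

sum-const : ∀ n c → sum {n} (λ _ → c) ≡ + n * c
sum-const zero    c = refl
sum-const (suc n) c = trans (cong (_+_ c) (sum-const n c)) (sym (ℤ.suc-* (+ n) c))

sum-zero : ∀ n → sum {n} (λ _ → 0ℤ) ≡ 0ℤ
sum-zero n = trans (sum-const n 0ℤ) (ℤ.*-zeroʳ (+ n))

sum-Iverson : ∀ {n} (f : Fin n → ℤ) o → sum (λ i → f i * [ i Fin.≟ o ]) ≡ f o
sum-Iverson {suc n} f fz = begin
  f fz * 1ℤ + sum (λ i → f (fs i) * 0ℤ) ≡⟨ cong₂ _+_ (ℤ.*-identityʳ (f fz)) (sum-cong-≗ (ℤ.*-zeroʳ ∘ f ∘ fs)) ⟩
  f fz + sum {n} (λ _ → 0ℤ)             ≡⟨ cong (_+_ (f fz)) (sum-zero n) ⟩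
  f fz + 0ℤ                             ≡⟨ ℤ.+-identityʳ (f fz) ⟩
  f fz                                  ∎
sum-Iverson {suc n} f (fs o) = begin
  f fz * 0ℤ + sum (λ i → f (fs i) * [ i Fin.≟ o ]) ≡⟨ cong₂ _+_ (ℤ.*-zeroʳ (f fz)) (sum-Iverson (f ∘ fs) o) ⟩
  0ℤ + f (fs o)                                    ≡⟨ ℤ.+-identityˡ (f (fs o)) ⟩
  f (fs o)                                         ∎

∣⇒≡-below-double : ∀ {p k} → 0 ℕ.< k → k ℕ.< p ℕ.+ p → p ∣ k → k ≡ p
∣⇒≡-below-double 0<k k<2p (divides zero          refl) = ⊥-elim (ℕ.<-irrefl refl 0<k)
∣⇒≡-below-double 0<k k<2p (divides (suc zero)    refl) = ℕ.+-identityʳ _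
∣⇒≡-below-double {p} 0<k k<2p (divides (suc (suc q)) refl) =
  ⊥-elim (ℕ.<⇒≱ k<2p (ℕ.+-monoʳ-≤ p (ℕ.m≤m+n p (q ℕ.* p))))

module _ {m : ℕ} (i j : Fin m) where

  index-sum≡⇒opposite : suc (toℕ i) ℕ.+ suc (toℕ j) ≡ suc m → i ≡ opposite j
  index-sum≡⇒opposite eq = Fin.toℕ-injective (begin
    toℕ i                          ≡⟨ ℕ.m+n∸n≡m (toℕ i) (suc (toℕ j)) ⟨
    toℕ i ℕ.+ suc (toℕ j) ∸ suc (toℕ j) ≡⟨ cong (_∸ suc (toℕ j)) (ℕ.suc-injective eq) ⟩
    m ∸ suc (toℕ j)                ≡⟨ Fin.opposite-prop j ⟨
    toℕ (opposite j)               ∎)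

  opposite⇒index-sum≡ : i ≡ opposite j → suc (toℕ i) ℕ.+ suc (toℕ j) ≡ suc m
  opposite⇒index-sum≡ refl = cong suc (begin
    toℕ (opposite j) ℕ.+ suc (toℕ j) ≡⟨ cong (ℕ._+ suc (toℕ j)) (Fin.opposite-prop j) ⟩
    m ∸ suc (toℕ j) ℕ.+ suc (toℕ j)  ≡⟨ ℕ.m∸n+n≡m (Fin.toℕ<n j) ⟩
    m                                ∎)

  index-sum<double : suc (toℕ i) ℕ.+ suc (toℕ j) ℕ.< suc m ℕ.+ suc m
  index-sum<double = ℕ.+-mono-< (ℕ.s<s (Fin.toℕ<n i)) (ℕ.s<s (Fin.toℕ<n j))

  trPow-index-sum : trPow (suc m) (suc (toℕ i) ℕ.+ suc (toℕ j)) ≡ -1ℤ + + suc m * [ i Fin.≟ opposite j ]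
  trPow-index-sum with suc m ∣? suc (toℕ i) ℕ.+ suc (toℕ j) | i Fin.≟ opposite j
  ... | yes _   | yes _   = p-1≡-1+p (+ m)
    where
    p-1≡-1+p : ∀ m → m ≡ -1ℤ + (1ℤ + m) * 1ℤ
    p-1≡-1+p = solve-∀
  ... | yes p∣k | no i≢oj =
    ⊥-elim (i≢oj (index-sum≡⇒opposite (∣⇒≡-below-double (ℕ.s≤s ℕ.z≤n) index-sum<double p∣k)))
  ... | no p∤k  | yes i≡oj = ⊥-elim (p∤k (subst (suc m ∣_) (sym (opposite⇒index-sum≡ i≡oj)) ∣-refl))
  ... | no _    | no _    = sym (trans (cong (_+_ -1ℤ) (ℤ.*-zeroʳ (+ suc m))) (ℤ.+-identityʳ -1ℤ))

sum-opposite : ∀ {n} (f : Fin n → ℤ) → sum (λ j → f (opposite j)) ≡ sum f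
sum-opposite f = sym (∑-permute f Perm.reverse)

sum-*ˡ : ∀ {n} k (f : Fin n → ℤ) → sum (λ i → k * f i) ≡ k * sum f
sum-*ˡ k f = sym (*-distribˡ-sum k f)

module _ {m : ℕ} (γ : Fin m → ℤ) where

  private
    P S : ℤ
    P = + suc m
    S = coordSum m γ

  trTimesPow-coordinates : ∀ j → trTimesPow (suc m) γ (suc (toℕ j)) ≡ -1ℤ * S + P * γ (opposite j)
  trTimesPow-coordinates j = begin
    sumFin m (λ i → γ i * trPow (suc m) (suc (toℕ i) ℕ.+ suc (toℕ j)))
      ≡⟨ sumFin≡sum m (λ i → γ i * trPow (suc m) (suc (toℕ i) ℕ.+ suc (toℕ j))) ⟩
    sum (λ i → γ i * trPow (suc m) (suc (toℕ i) ℕ.+ suc (toℕ j)))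
      ≡⟨ sum-cong-≗ (λ i → trans (cong (_*_ (γ i)) (trPow-index-sum i j)) (split P (γ i) [ i Fin.≟ opposite j ])) ⟩
    sum (λ i → -1ℤ * γ i + P * (γ i * [ i Fin.≟ opposite j ]))
      ≡⟨ ∑-distrib-+ (λ i → -1ℤ * γ i) (λ i → P * (γ i * [ i Fin.≟ opposite j ])) ⟩
    sum (λ i → -1ℤ * γ i) + sum (λ i → P * (γ i * [ i Fin.≟ opposite j ]))
      ≡⟨ cong₂ _+_ (sum-*ˡ -1ℤ γ) (sum-*ˡ P (λ i → γ i * [ i Fin.≟ opposite j ])) ⟩
    -1ℤ * sum γ + P * sum (λ i → γ i * [ i Fin.≟ opposite j ])
      ≡⟨ cong₂ (λ s t → -1ℤ * s + P * t) (sym (sumFin≡sum m γ)) (sum-Iverson γ (opposite j)) ⟩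
    -1ℤ * S + P * γ (opposite j) ∎
    where
    split : ∀ P g δ → g * (-1ℤ + P * δ) ≡ -1ℤ * g + P * (g * δ)
    split = solve-∀

  normSq-coordinates : normSq (suc m) γ ≡ P * P * squareSum m γ - (P + 1ℤ) * (S * S)
  normSq-coordinates = begin
    sumFin m (λ j → trTimesPow (suc m) γ (suc (toℕ j)) * trTimesPow (suc m) γ (suc (toℕ j)))
      ≡⟨ sumFin≡sum m (λ j → trTimesPow (suc m) γ (suc (toℕ j)) * trTimesPow (suc m) γ (suc (toℕ j))) ⟩
    sum {m} (λ j → trTimesPow (suc m) γ (suc (toℕ j)) * trTimesPow (suc m) γ (suc (toℕ j)))
      ≡⟨ sum-cong-≗ (λ j → trans (cong (λ t → t * t) (trTimesPow-coordinates j)) (expand S P (γ (opposite j)))) ⟩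
    sum {m} (λ j → P * P * (γ (opposite j) * γ (opposite j)) + (-2PS * γ (opposite j) + S * S))
      ≡⟨ trans (∑-distrib-+ (λ j → P * P * (γ′ j * γ′ j)) (λ j → -2PS * γ′ j + S * S))
               (cong (_+_ (sum {m} (λ j → P * P * (γ′ j * γ′ j)))) (∑-distrib-+ (λ j → -2PS * γ′ j) (λ _ → S * S))) ⟩
    sum {m} (λ j → P * P * (γ (opposite j) * γ (opposite j))) + (sum {m} (λ j → -2PS * γ (opposite j)) + sum {m} (λ _ → S * S))
      ≡⟨ cong₂ _+_ (sum-*ˡ (P * P) (λ j → γ′ j * γ′ j)) (cong₂ _+_ (sum-*ˡ -2PS γ′) (sum-const m (S * S))) ⟩
    P * P * sum {m} (λ j → γ (opposite j) * γ (opposite j)) + (-2PS * sum {m} (λ j → γ (opposite j)) + + m * (S * S))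
      ≡⟨ cong₂ (λ q s → P * P * q + (-2PS * s + + m * (S * S))) (sum-opposite (λ i → γ i * γ i)) (sum-opposite γ) ⟩
    P * P * sum {m} (λ i → γ i * γ i) + (-2PS * sum γ + + m * (S * S))
      ≡⟨ cong₂ (λ q s → P * P * q + (-2PS * s + + m * (S * S)))
               (sym (sumFin≡sum m (λ i → γ i * γ i))) (sym (sumFin≡sum m γ)) ⟩
    P * P * squareSum m γ + (-2PS * S + + m * (S * S))
      ≡⟨ collect (squareSum m γ) S (+ m) ⟩
    P * P * squareSum m γ - (P + 1ℤ) * (S * S) ∎
    where
    γ′ : Fin m → ℤ
    γ′ j = γ (opposite j)
    -2PS : ℤ
    -2PS = - (+ 2 * P * S)
    expand : ∀ S P g → (-1ℤ * S + P * g) * (-1ℤ * S + P * g) ≡ P * P * (g * g) + (- (+ 2 * P * S) * g + S * S)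
    expand = solve-∀
    collect : ∀ Q S M → (1ℤ + M) * (1ℤ + M) * Q + (- (+ 2 * (1ℤ + M) * S) * S + M * (S * S))
                      ≡ (1ℤ + M) * (1ℤ + M) * Q - ((1ℤ + M) + 1ℤ) * (S * S)
    collect = solve-∀

diffSum : List ℤ → (ℤ → ℤ) → ℤ
diffSum xs f = ∑[ x ∈ xs ] ∑[ y ∈ xs ] f (x - y)

pairSum : (m N : ℕ) → ((Fin m → ℤ) → ℤ) → ℤ
pairSum m N h = ∑[ α ∈ box m N ] ∑[ β ∈ box m N ] h (λ i → α i - β i)

-- Swapping x and y negates the sum.
diffSum-odd : ∀ xs (f : ℤ → ℤ) → (∀ t → f (- t) ≡ - f t) → diffSum xs f ≡ 0ℤ
diffSum-odd xs f odd = self-negating (begin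
  diffSum xs f                          ≡⟨ ∑-comm xs xs (λ x y → f (x - y)) ⟩
  ∑[ y ∈ xs ] ∑[ x ∈ xs ] f (x - y)     ≡⟨ ∑-cong xs (λ y → ∑-cong xs (λ x → trans (cong f (swap x y)) (odd (y - x)))) ⟩
  ∑[ y ∈ xs ] ∑[ x ∈ xs ] - f (y - x)   ≡⟨ ∑-cong xs (λ y → ∑-neg xs (λ x → f (y - x))) ⟩
  ∑[ y ∈ xs ] - (∑[ x ∈ xs ] f (y - x)) ≡⟨ ∑-neg xs (λ y → ∑[ x ∈ xs ] f (y - x)) ⟩
  - diffSum xs f                        ∎)
  where
  swap : ∀ x y → x - y ≡ - (y - x)
  swap = solve-∀
  self-negating : ∀ {s} → s ≡ - s → s ≡ 0ℤ
  self-negating {s} s≡-s = ℤ.*-cancelˡ-≡ (+ 2) s 0ℤ (begin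
    + 2 * s   ≡⟨ double s ⟩
    s + s     ≡⟨ cong (_+_ s) s≡-s ⟩
    s + - s   ≡⟨ ℤ.+-inverseʳ s ⟩
    0ℤ        ≡⟨ ℤ.*-zeroʳ (+ 2) ⟨
    + 2 * 0ℤ  ∎)
    where
    double : ∀ s → + 2 * s ≡ s + s
    double = solve-∀

module _ (m N : ℕ) where

  pairSum-cong : ∀ {g h : (Fin m → ℤ) → ℤ} → (∀ c → g c ≡ h c) → pairSum m N g ≡ pairSum m N h
  pairSum-cong g≗h = ∑-cong (box m N) (λ α → ∑-cong (box m N) (λ β → g≗h _))

  pairSum-∑ : ∀ {T : Set} (ts : List T) (h : T → (Fin m → ℤ) → ℤ) →
    pairSum m N (λ c → ∑[ t ∈ ts ] h t c) ≡ ∑[ t ∈ ts ] pairSum m N (h t)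
  pairSum-∑ ts h = begin
    ∑[ α ∈ box m N ] ∑[ β ∈ box m N ] ∑[ t ∈ ts ] h t (α -ᶜ β)
      ≡⟨ ∑-cong (box m N) (λ α → ∑-comm (box m N) ts _) ⟩
    ∑[ α ∈ box m N ] ∑[ t ∈ ts ] ∑[ β ∈ box m N ] h t (α -ᶜ β) ≡⟨ ∑-comm (box m N) ts _ ⟩
    ∑[ t ∈ ts ] ∑[ α ∈ box m N ] ∑[ β ∈ box m N ] h t (α -ᶜ β) ∎
    where
    _-ᶜ_ : (Fin m → ℤ) → (Fin m → ℤ) → Fin m → ℤ
    (α -ᶜ β) i = α i - β i

  pairSum-*ˡ : ∀ k (h : (Fin m → ℤ) → ℤ) → pairSum m N (λ c → k * h c) ≡ k * pairSum m N h
  pairSum-*ˡ k h = trans (∑-cong (box m N) (λ α → ∑-*ˡ (box m N) k _)) (∑-*ˡ (box m N) k _)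

  pairSum-linear : (ts : List (ℤ × ((Fin m → ℤ) → ℤ))) →
    pairSum m N (λ c → ∑[ t ∈ ts ] proj₁ t * proj₂ t c) ≡ ∑[ t ∈ ts ] proj₁ t * pairSum m N (proj₂ t)
  pairSum-linear ts = trans (pairSum-∑ ts (λ t c → proj₁ t * proj₂ t c)) (∑-cong ts (λ t → pairSum-*ˡ (proj₁ t) (proj₂ t)))

  ∑-box-suc : (f : ℤ → (Fin m → ℤ) → ℤ) →
    ∑[ α ∈ box (suc m) N ] f (head α) (tail α) ≡ ∑[ x ∈ range N ] ∑[ α ∈ box m N ] f x α
  ∑-box-suc f = ∑-concatMap-map (range N) (box m N) _ (λ α → f (head α) (tail α))

  -- The coordinates of a difference of two points of the box vary independently.
  pairSum-suc : ∀ (f : ℤ → ℤ) (g : (Fin m → ℤ) → ℤ) →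
    pairSum (suc m) N (λ c → f (head c) * g (tail c)) ≡ diffSum (range N) f * pairSum m N g
  pairSum-suc f g = begin
    pairSum (suc m) N (λ c → f (head c) * g (tail c))
      ≡⟨ ∑-box-suc (λ x a → ∑[ β ∈ box (suc m) N ] f (x - head β) * g (λ i → a i - tail β i)) ⟩
    ∑[ x ∈ range N ] ∑[ a ∈ box m N ] ∑[ β ∈ box (suc m) N ] f (x - head β) * g (λ i → a i - tail β i)
      ≡⟨ ∑-cong (range N) (λ x → ∑-cong (box m N) (λ a → ∑-box-suc (λ y b → f (x - y) * g (λ i → a i - b i)))) ⟩
    ∑[ x ∈ range N ] ∑[ a ∈ box m N ] ∑[ y ∈ range N ] ∑[ b ∈ box m N ] f (x - y) * g (λ i → a i - b i)
      ≡⟨ ∑-cong (range N) (λ x → ∑-comm (box m N) (range N) (λ a y → ∑[ b ∈ box m N ] f (x - y) * g (λ i → a i - b i))) ⟩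
    ∑[ x ∈ range N ] ∑[ y ∈ range N ] ∑[ a ∈ box m N ] ∑[ b ∈ box m N ] f (x - y) * g (λ i → a i - b i)
      ≡⟨ ∑-cong (range N) (λ x → ∑-cong (range N) (λ y →
           trans (∑-cong (box m N) (λ a → ∑-*ˡ (box m N) (f (x - y)) (λ b → g (λ i → a i - b i))))
                 (∑-*ˡ (box m N) (f (x - y)) (λ a → ∑[ b ∈ box m N ] g (λ i → a i - b i))))) ⟩
    ∑[ x ∈ range N ] ∑[ y ∈ range N ] f (x - y) * pairSum m N g
      ≡⟨ trans (∑-cong (range N) (λ x → ∑-*ʳ (range N) (pairSum m N g) (λ y → f (x - y))))
               (∑-*ʳ (range N) (pairSum m N g) (λ x → ∑[ y ∈ range N ] f (x - y))) ⟩
    diffSum (range N) f * pairSum m N g ∎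

SeparableTerms : ℕ → Set
SeparableTerms m = List ((ℤ → ℤ) × ((Fin m → ℤ) → ℤ))

pairSum-separable : ∀ m N (h : (Fin (suc m) → ℤ) → ℤ) (ts : SeparableTerms m) →
  (∀ c → h c ≡ ∑[ t ∈ ts ] proj₁ t (head c) * proj₂ t (tail c)) →
  pairSum (suc m) N h ≡ ∑[ t ∈ ts ] diffSum (range N) (proj₁ t) * pairSum m N (proj₂ t)
pairSum-separable m N h ts expand = begin
  pairSum (suc m) N h
    ≡⟨ pairSum-cong (suc m) N expand ⟩
  pairSum (suc m) N (λ c → ∑[ t ∈ ts ] proj₁ t (head c) * proj₂ t (tail c))
    ≡⟨ pairSum-∑ (suc m) N ts (λ t c → proj₁ t (head c) * proj₂ t (tail c)) ⟩
  ∑[ t ∈ ts ] pairSum (suc m) N (λ c → proj₁ t (head c) * proj₂ t (tail c))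
    ≡⟨ ∑-cong ts (λ t → pairSum-suc m N (proj₁ t) (proj₂ t)) ⟩
  ∑[ t ∈ ts ] diffSum (range N) (proj₁ t) * pairSum m N (proj₂ t) ∎

-- Moments of the difference of two coordinates

powerSum₁ : ∀ n → + 2 * (∑[ i ∈ upTo n ] + i) ≡ + n * (+ n - 1ℤ)
powerSum₁ n = trans (sym (∑-*ˡ (upTo n) (+ 2) (λ i → + i)))
  (∑-upTo-telescope (λ x → x * (x - 1ℤ)) (λ x → + 2 * x) (λ x → Δ x) refl n)
  where
  Δ : ∀ x → (1ℤ + x) * (1ℤ + x - 1ℤ) - x * (x - 1ℤ) ≡ + 2 * x
  Δ = solve-∀

powerSum₂ : ∀ n → + 6 * (∑[ i ∈ upTo n ] + i * + i) ≡ + n * (+ n - 1ℤ) * (+ 2 * + n - 1ℤ)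
powerSum₂ n = trans (sym (∑-*ˡ (upTo n) (+ 6) (λ i → + i * + i)))
  (∑-upTo-telescope (λ x → x * (x - 1ℤ) * (+ 2 * x - 1ℤ)) (λ x → + 6 * (x * x)) (λ x → Δ x) refl n)
  where
  Δ : ∀ x → (1ℤ + x) * (1ℤ + x - 1ℤ) * (+ 2 * (1ℤ + x) - 1ℤ) - x * (x - 1ℤ) * (+ 2 * x - 1ℤ) ≡ + 6 * (x * x)
  Δ = solve-∀

powerSum₃ : ∀ n → + 4 * (∑[ i ∈ upTo n ] + i * + i * + i) ≡ + n * + n * (+ n - 1ℤ) * (+ n - 1ℤ)
powerSum₃ n = trans (sym (∑-*ˡ (upTo n) (+ 4) (λ i → + i * + i * + i)))
  (∑-upTo-telescope (λ x → x * x * (x - 1ℤ) * (x - 1ℤ)) (λ x → + 4 * (x * x * x)) (λ x → Δ x) refl n)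
  where
  Δ : ∀ x → (1ℤ + x) * (1ℤ + x) * (1ℤ + x - 1ℤ) * (1ℤ + x - 1ℤ) - x * x * (x - 1ℤ) * (x - 1ℤ) ≡ + 4 * (x * x * x)
  Δ = solve-∀

powerSum₄ : ∀ n → + 30 * (∑[ i ∈ upTo n ] + i * + i * (+ i * + i))
                ≡ + n * (+ n - 1ℤ) * (+ 2 * + n - 1ℤ) * (+ 3 * + n * + n - + 3 * + n - 1ℤ)
powerSum₄ n = trans (sym (∑-*ˡ (upTo n) (+ 30) (λ i → + i * + i * (+ i * + i))))
  (∑-upTo-telescope F (λ x → + 30 * (x * x * (x * x))) (λ x → Δ x) refl n)
  where
  F : ℤ → ℤ
  F x = x * (x - 1ℤ) * (+ 2 * x - 1ℤ) * (+ 3 * x * x - + 3 * x - 1ℤ)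
  Δ : ∀ x → (1ℤ + x) * (1ℤ + x - 1ℤ) * (+ 2 * (1ℤ + x) - 1ℤ) * (+ 3 * (1ℤ + x) * (1ℤ + x) - + 3 * (1ℤ + x) - 1ℤ)
              - x * (x - 1ℤ) * (+ 2 * x - 1ℤ) * (+ 3 * x * x - + 3 * x - 1ℤ) ≡ + 30 * (x * x * (x * x))
  Δ = solve-∀

module CoordinateMoments (N : ℕ) where

  n a b : ℤ
  n = + suc (2 ℕ.* N)
  a = α₂ (+ N)
  b = α₄ (+ N)

  e₀ e₁ e₂ e₃ e₄ : ℤ
  e₀ = diffSum (range N) (λ _ → 1ℤ)
  e₁ = diffSum (range N) (λ t → t)
  e₂ = diffSum (range N) (λ t → t * t)
  e₃ = diffSum (range N) (λ t → t * t * t)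
  e₄ = diffSum (range N) (λ t → t * t * (t * t))

  e₁≡0 : e₁ ≡ 0ℤ
  e₁≡0 = diffSum-odd (range N) (λ t → t) (λ t → refl)

  e₃≡0 : e₃ ≡ 0ℤ
  e₃≡0 = diffSum-odd (range N) (λ t → t * t * t) odd
    where
    odd : ∀ t → - t * - t * - t ≡ - (t * t * t)
    odd = solve-∀

  private
    I : List ℕ
    I = upTo (suc (2 ℕ.* N))

    s₀ s₁ s₂ s₃ s₄ : ℤ
    s₀ = ∑[ i ∈ I ] 1ℤ
    s₁ = ∑[ i ∈ I ] + i
    s₂ = ∑[ i ∈ I ] + i * + i
    s₃ = ∑[ i ∈ I ] + i * + i * + i
    s₄ = ∑[ i ∈ I ] + i * + i * (+ i * + i)

    s₀≡n : s₀ ≡ n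
    s₀≡n = trans (∑-const I 1ℤ) (trans (ℤ.*-identityʳ (+ length I)) (cong +_ (List.length-upTo (suc (2 ℕ.* N)))))

  -- Only differences enter, so [-N, N] may be shifted to [0, 2N].
  diffSum-separable : ∀ (f : ℤ → ℤ) (ts : List ((ℤ → ℤ) × (ℤ → ℤ))) →
    (∀ x y → f (x - y) ≡ ∑[ t ∈ ts ] proj₁ t x * proj₂ t y) →
    diffSum (range N) f ≡ ∑[ t ∈ ts ] (∑[ i ∈ I ] proj₁ t (+ i)) * (∑[ j ∈ I ] proj₂ t (+ j))
  diffSum-separable f ts expand = begin
    diffSum (range N) f
      ≡⟨ ∑-map shift I (λ x → ∑[ y ∈ range N ] f (x - y)) ⟩
    ∑[ i ∈ I ] ∑[ y ∈ range N ] f (shift i - y)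
      ≡⟨ ∑-cong I (λ i → ∑-map shift I (λ y → f (shift i - y))) ⟩
    ∑[ i ∈ I ] ∑[ j ∈ I ] f (shift i - shift j)
      ≡⟨ ∑-cong I (λ i → ∑-cong I (λ j → trans (cong f (unshift (+ i) (+ j) (+ N))) (expand (+ i) (+ j)))) ⟩
    ∑[ i ∈ I ] ∑[ j ∈ I ] ∑[ t ∈ ts ] proj₁ t (+ i) * proj₂ t (+ j)
      ≡⟨ ∑-separable I I ts (λ t i → proj₁ t (+ i)) (λ t j → proj₂ t (+ j)) ⟩
    ∑[ t ∈ ts ] (∑[ i ∈ I ] proj₁ t (+ i)) * (∑[ j ∈ I ] proj₂ t (+ j)) ∎
    where
    shift : ℕ → ℤ
    shift i = + i - + N
    unshift : ∀ x y c → (x - c) - (y - c) ≡ x - y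
    unshift = solve-∀

  e₀-value : e₀ ≡ n * n
  e₀-value = begin
    e₀                ≡⟨ diffSum-separable (λ _ → 1ℤ) ((const 1ℤ , const 1ℤ) ∷ []) (λ x y → refl) ⟩
    s₀ * s₀ + 0ℤ      ≡⟨ ℤ.+-identityʳ (s₀ * s₀) ⟩
    s₀ * s₀           ≡⟨ cong₂ _*_ s₀≡n s₀≡n ⟩
    n * n             ∎

  private
    six-e₂ : + 6 * e₂ ≡ n * n * (n * n - 1ℤ)
    six-e₂ = begin
      + 6 * e₂
        ≡⟨ cong (+ 6 *_) (diffSum-separable (λ t → t * t) ts expand) ⟩
      + 6 * (s₂ * s₀ + ((∑[ i ∈ I ] - + 2 * + i) * s₁ + (s₀ * s₂ + 0ℤ)))
        ≡⟨ cong (λ a → + 6 * (s₂ * s₀ + (a * s₁ + (s₀ * s₂ + 0ℤ)))) (∑-*ˡ I (- + 2) (λ i → + i)) ⟩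
      + 6 * (s₂ * s₀ + (- + 2 * s₁ * s₁ + (s₀ * s₂ + 0ℤ)))
        ≡⟨ regroup s₀ s₁ s₂ ⟩
      + 2 * s₀ * (+ 6 * s₂) - + 3 * ((+ 2 * s₁) * (+ 2 * s₁))
        ≡⟨ cong₂ (λ a b → + 2 * a * b - + 3 * ((+ 2 * s₁) * (+ 2 * s₁))) s₀≡n (powerSum₂ (suc (2 ℕ.* N))) ⟩
      + 2 * n * (n * (n - 1ℤ) * (+ 2 * n - 1ℤ)) - + 3 * ((+ 2 * s₁) * (+ 2 * s₁))
        ≡⟨ cong (λ a → + 2 * n * (n * (n - 1ℤ) * (+ 2 * n - 1ℤ)) - + 3 * (a * a)) (powerSum₁ (suc (2 ℕ.* N))) ⟩
      + 2 * n * (n * (n - 1ℤ) * (+ 2 * n - 1ℤ)) - + 3 * ((n * (n - 1ℤ)) * (n * (n - 1ℤ)))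
        ≡⟨ finish n ⟩
      n * n * (n * n - 1ℤ) ∎
      where
      ts : List ((ℤ → ℤ) × (ℤ → ℤ))
      ts = ((λ x → x * x) , const 1ℤ) ∷ ((λ x → - + 2 * x) , (λ y → y)) ∷ (const 1ℤ , (λ y → y * y)) ∷ []
      expand : ∀ x y → (x - y) * (x - y) ≡ x * x * 1ℤ + (- + 2 * x * y + (1ℤ * (y * y) + 0ℤ))
      expand = solve-∀
      regroup : ∀ s₀ s₁ s₂ → + 6 * (s₂ * s₀ + (- + 2 * s₁ * s₁ + (s₀ * s₂ + 0ℤ)))
                           ≡ + 2 * s₀ * (+ 6 * s₂) - + 3 * ((+ 2 * s₁) * (+ 2 * s₁))
      regroup = solve-∀
      finish : ∀ n → + 2 * n * (n * (n - 1ℤ) * (+ 2 * n - 1ℤ)) - + 3 * ((n * (n - 1ℤ)) * (n * (n - 1ℤ)))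
                   ≡ n * n * (n * n - 1ℤ)
      finish = solve-∀

    thirty-e₄ : + 30 * e₄ ≡ n * n * (n * n - 1ℤ) * (+ 2 * (n * n) - + 3)
    thirty-e₄ = begin
      + 30 * e₄
        ≡⟨ cong (+ 30 *_) (diffSum-separable (λ t → t * t * (t * t)) ts expand) ⟩
      + 30 * (s₄ * s₀ + (c₃ * s₁ + (c₂ * s₂ + (c₁ * s₃ + (s₀ * s₄ + 0ℤ)))))
        ≡⟨ cong₂ (λ a b → + 30 * (s₄ * s₀ + (a * s₁ + (b * s₂ + (c₁ * s₃ + (s₀ * s₄ + 0ℤ))))))
                 (∑-*ˡ I (- + 4) (λ i → + i * + i * + i)) (∑-*ˡ I (+ 6) (λ i → + i * + i)) ⟩
      + 30 * (s₄ * s₀ + (- + 4 * s₃ * s₁ + (+ 6 * s₂ * s₂ + (c₁ * s₃ + (s₀ * s₄ + 0ℤ)))))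
        ≡⟨ cong (λ a → + 30 * (s₄ * s₀ + (- + 4 * s₃ * s₁ + (+ 6 * s₂ * s₂ + (a * s₃ + (s₀ * s₄ + 0ℤ))))))
                (∑-*ˡ I (- + 4) (λ i → + i)) ⟩
      + 30 * (s₄ * s₀ + (- + 4 * s₃ * s₁ + (+ 6 * s₂ * s₂ + (- + 4 * s₁ * s₃ + (s₀ * s₄ + 0ℤ)))))
        ≡⟨ regroup s₀ s₁ s₂ s₃ s₄ ⟩
      + 2 * s₀ * (+ 30 * s₄) - + 30 * ((+ 2 * s₁) * (+ 4 * s₃)) + + 5 * ((+ 6 * s₂) * (+ 6 * s₂))
        ≡⟨ cong₂ (λ a b → + 2 * a * b - + 30 * ((+ 2 * s₁) * (+ 4 * s₃)) + + 5 * ((+ 6 * s₂) * (+ 6 * s₂)))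
                 s₀≡n (powerSum₄ (suc (2 ℕ.* N))) ⟩
      + 2 * n * p₄ - + 30 * ((+ 2 * s₁) * (+ 4 * s₃)) + + 5 * ((+ 6 * s₂) * (+ 6 * s₂))
        ≡⟨ cong₂ (λ a b → + 2 * n * p₄ - + 30 * (a * b) + + 5 * ((+ 6 * s₂) * (+ 6 * s₂)))
                 (powerSum₁ (suc (2 ℕ.* N))) (powerSum₃ (suc (2 ℕ.* N))) ⟩
      + 2 * n * p₄ - + 30 * (p₁ * p₃) + + 5 * ((+ 6 * s₂) * (+ 6 * s₂))
        ≡⟨ cong (λ a → + 2 * n * p₄ - + 30 * (p₁ * p₃) + + 5 * (a * a)) (powerSum₂ (suc (2 ℕ.* N))) ⟩
      + 2 * n * p₄ - + 30 * (p₁ * p₃) + + 5 * (p₂ * p₂)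
        ≡⟨ finish n ⟩
      n * n * (n * n - 1ℤ) * (+ 2 * (n * n) - + 3) ∎
      where
      c₁ c₂ c₃ p₁ p₂ p₃ p₄ : ℤ
      c₁ = ∑[ i ∈ I ] - + 4 * + i
      c₂ = ∑[ i ∈ I ] + 6 * (+ i * + i)
      c₃ = ∑[ i ∈ I ] - + 4 * (+ i * + i * + i)
      p₁ = n * (n - 1ℤ)
      p₂ = n * (n - 1ℤ) * (+ 2 * n - 1ℤ)
      p₃ = n * n * (n - 1ℤ) * (n - 1ℤ)
      p₄ = n * (n - 1ℤ) * (+ 2 * n - 1ℤ) * (+ 3 * n * n - + 3 * n - 1ℤ)
      ts : List ((ℤ → ℤ) × (ℤ → ℤ))
      ts = ((λ x → x * x * (x * x)) , const 1ℤ) ∷ ((λ x → - + 4 * (x * x * x)) , (λ y → y))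
         ∷ ((λ x → + 6 * (x * x)) , (λ y → y * y)) ∷ ((λ x → - + 4 * x) , (λ y → y * y * y))
         ∷ (const 1ℤ , (λ y → y * y * (y * y))) ∷ []
      expand : ∀ x y → (x - y) * (x - y) * ((x - y) * (x - y))
                     ≡ x * x * (x * x) * 1ℤ + (- + 4 * (x * x * x) * y + (+ 6 * (x * x) * (y * y)
                       + (- + 4 * x * (y * y * y) + (1ℤ * (y * y * (y * y)) + 0ℤ))))
      expand = solve-∀
      regroup : ∀ s₀ s₁ s₂ s₃ s₄ → + 30 * (s₄ * s₀ + (- + 4 * s₃ * s₁ + (+ 6 * s₂ * s₂ + (- + 4 * s₁ * s₃ + (s₀ * s₄ + 0ℤ)))))
                  ≡ + 2 * s₀ * (+ 30 * s₄) - + 30 * ((+ 2 * s₁) * (+ 4 * s₃)) + + 5 * ((+ 6 * s₂) * (+ 6 * s₂))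
      regroup = solve-∀
      finish : ∀ n → + 2 * n * (n * (n - 1ℤ) * (+ 2 * n - 1ℤ) * (+ 3 * n * n - + 3 * n - 1ℤ))
                     - + 30 * (n * (n - 1ℤ) * (n * n * (n - 1ℤ) * (n - 1ℤ)))
                     + + 5 * (n * (n - 1ℤ) * (+ 2 * n - 1ℤ) * (n * (n - 1ℤ) * (+ 2 * n - 1ℤ)))
                   ≡ n * n * (n * n - 1ℤ) * (+ 2 * (n * n) - + 3)
      finish = solve-∀


    n²≡1+2a : n * n ≡ 1ℤ + + 2 * a
    n²≡1+2a = trans (cong (λ x → x * x) (cong (_+_ 1ℤ) (ℤ.pos-* 2 N))) (square (+ N))
      where
      square : ∀ N → (1ℤ + + 2 * N) * (1ℤ + + 2 * N) ≡ 1ℤ + + 2 * (+ 2 * N * (N + 1ℤ))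
      square = solve-∀

  e₂-value : + 3 * e₂ ≡ a * e₀
  e₂-value = ℤ.*-cancelˡ-≡ (+ 2) (+ 3 * e₂) (a * e₀) (begin
    + 2 * (+ 3 * e₂)                    ≡⟨ ℤ.*-assoc (+ 2) (+ 3) e₂ ⟨
    + 6 * e₂                            ≡⟨ six-e₂ ⟩
    n * n * (n * n - 1ℤ)                ≡⟨ cong (λ x → x * (x - 1ℤ)) n²≡1+2a ⟩
    (1ℤ + + 2 * a) * (1ℤ + + 2 * a - 1ℤ) ≡⟨ collect a ⟩
    + 2 * (a * (1ℤ + + 2 * a))          ≡⟨ cong (λ x → + 2 * (a * x)) (trans e₀-value n²≡1+2a) ⟨
    + 2 * (a * e₀)                      ∎)
    where
    collect : ∀ a → (1ℤ + + 2 * a) * (1ℤ + + 2 * a - 1ℤ) ≡ + 2 * (a * (1ℤ + + 2 * a))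
    collect = solve-∀

  e₄-value : + 15 * e₄ ≡ b * e₀
  e₄-value = ℤ.*-cancelˡ-≡ (+ 2) (+ 15 * e₄) (b * e₀) (begin
    + 2 * (+ 15 * e₄)                   ≡⟨ ℤ.*-assoc (+ 2) (+ 15) e₄ ⟨
    + 30 * e₄                           ≡⟨ thirty-e₄ ⟩
    n * n * (n * n - 1ℤ) * (+ 2 * (n * n) - + 3)
                                        ≡⟨ cong (λ x → x * (x - 1ℤ) * (+ 2 * x - + 3)) n²≡1+2a ⟩
    (1ℤ + + 2 * a) * (1ℤ + + 2 * a - 1ℤ) * (+ 2 * (1ℤ + + 2 * a) - + 3)
                                        ≡⟨ collect a ⟩
    + 2 * (a * (+ 4 * a - 1ℤ) * (1ℤ + + 2 * a)) ≡⟨ cong (λ x → + 2 * (b * x)) (trans e₀-value n²≡1+2a) ⟨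
    + 2 * (b * e₀)                      ∎)
    where
    collect : ∀ a → (1ℤ + + 2 * a) * (1ℤ + + 2 * a - 1ℤ) * (+ 2 * (1ℤ + + 2 * a) - + 3)
                  ≡ + 2 * (a * (+ 4 * a - 1ℤ) * (1ℤ + + 2 * a))
    collect = solve-∀

-- Recurrences in the dimension

module _ (e₀ : ℤ) (Z : ℕ → ℤ) (Z-suc : ∀ m → Z (suc m) ≡ e₀ * Z m) where

  linear-recurrence : ∀ {u : ℕ → ℤ} α → u 0 ≡ 0ℤ → (∀ m → u (suc m) ≡ e₀ * (α * Z m + u m)) →
    ∀ m → u m ≡ + m * α * Z m
  linear-recurrence {u} α u₀ u-suc zero    = u₀
  linear-recurrence {u} α u₀ u-suc (suc m) = begin
    u (suc m)                       ≡⟨ u-suc m ⟩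
    e₀ * (α * Z m + u m)            ≡⟨ cong (λ x → e₀ * (α * Z m + x)) (linear-recurrence α u₀ u-suc m) ⟩
    e₀ * (α * Z m + + m * α * Z m)  ≡⟨ collect e₀ α (Z m) (+ m) ⟩
    (1ℤ + + m) * α * (e₀ * Z m)     ≡⟨ cong (λ z → + suc m * α * z) (Z-suc m) ⟨
    + suc m * α * Z (suc m)         ∎
    where
    collect : ∀ e₀ α Z m → e₀ * (α * Z + m * α * Z) ≡ (1ℤ + m) * α * (e₀ * Z)
    collect = solve-∀

  quadratic-recurrence : ∀ {u v : ℕ → ℤ} α β γ → u 0 ≡ 0ℤ → (∀ m → v m ≡ + m * β * Z m) →
    (∀ m → u (suc m) ≡ e₀ * (α * Z m + γ * v m + u m)) →
    ∀ m → + 2 * u m ≡ (+ 2 * + m * α + + m * (+ m - 1ℤ) * γ * β) * Z m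
  quadratic-recurrence {u} {v} α β γ u₀ v-closed u-suc zero = cong (+ 2 *_) u₀
  quadratic-recurrence {u} {v} α β γ u₀ v-closed u-suc (suc m) = begin
    + 2 * u (suc m)
      ≡⟨ cong (+ 2 *_) (u-suc m) ⟩
    + 2 * (e₀ * (α * Z m + γ * v m + u m))
      ≡⟨ regroup e₀ α γ (Z m) (v m) (u m) ⟩
    e₀ * (+ 2 * α * Z m + + 2 * γ * v m + + 2 * u m)
      ≡⟨ cong₂ (λ x y → e₀ * (+ 2 * α * Z m + + 2 * γ * x + y))
               (v-closed m) (quadratic-recurrence α β γ u₀ v-closed u-suc m) ⟩
    e₀ * (+ 2 * α * Z m + + 2 * γ * (+ m * β * Z m) + (+ 2 * + m * α + + m * (+ m - 1ℤ) * γ * β) * Z m)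
      ≡⟨ collect e₀ α β γ (Z m) (+ m) ⟩
    (+ 2 * (1ℤ + + m) * α + (1ℤ + + m) * (1ℤ + + m - 1ℤ) * γ * β) * (e₀ * Z m)
      ≡⟨ cong (λ z → (+ 2 * + suc m * α + + suc m * (+ suc m - 1ℤ) * γ * β) * z) (Z-suc m) ⟨
    (+ 2 * + suc m * α + + suc m * (+ suc m - 1ℤ) * γ * β) * Z (suc m) ∎
    where
    regroup : ∀ e₀ α γ Z v u → + 2 * (e₀ * (α * Z + γ * v + u)) ≡ e₀ * (+ 2 * α * Z + + 2 * γ * v + + 2 * u)
    regroup = solve-∀
    collect : ∀ e₀ α β γ Z m → e₀ * (+ 2 * α * Z + + 2 * γ * (m * β * Z) + (+ 2 * m * α + m * (m - 1ℤ) * γ * β) * Z)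
                             ≡ (+ 2 * (1ℤ + m) * α + (1ℤ + m) * (1ℤ + m - 1ℤ) * γ * β) * (e₀ * Z)
    collect = solve-∀

module BoxMoments (N : ℕ) where

  open CoordinateMoments N

  count : ℕ → ℤ
  count m = pairSum m N (const 1ℤ)

  count-suc : ∀ m → count (suc m) ≡ e₀ * count m
  count-suc m = pairSum-suc m N (const 1ℤ) (const 1ℤ)

  count-positive : ∀ m → ∃ λ c → count m ≡ + suc c
  count-positive zero    = 0 , refl
  count-positive (suc m) with count-positive m
  ... | c , count≡ = _ , trans (count-suc m) (cong₂ _*_ e₀-value count≡)

  count≡L² : ∀ m → count m ≡ + (length (box m N) ℕ.* length (box m N))
  count≡L² m = begin
    ∑[ α ∈ box m N ] ∑[ β ∈ box m N ] 1ℤ  ≡⟨ ∑-cong (box m N) (λ α → ∑-const (box m N) 1ℤ) ⟩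
    ∑[ α ∈ box m N ] + L * 1ℤ             ≡⟨ ∑-const (box m N) (+ L * 1ℤ) ⟩
    + L * (+ L * 1ℤ)                      ≡⟨ cong (+ L *_) (ℤ.*-identityʳ (+ L)) ⟩
    + L * + L                             ≡⟨ ℤ.pos-* L L ⟨
    + (L ℕ.* L)                           ∎
    where
    L : ℕ
    L = length (box m N)

  Q S² Q² QS² S⁴ : ℕ → ℤ
  Q   m = pairSum m N (squareSum m)
  S²  m = pairSum m N (λ c → coordSum m c * coordSum m c)
  Q²  m = pairSum m N (λ c → squareSum m c * squareSum m c)
  QS² m = pairSum m N (λ c → squareSum m c * (coordSum m c * coordSum m c))
  S⁴  m = pairSum m N (λ c → coordSum m c * coordSum m c * (coordSum m c * coordSum m c))

  private
    linear-step : ∀ e₀ a Z u → a * e₀ * Z + e₀ * u ≡ e₀ * (a * Z + u)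
    linear-step = solve-∀

    quadratic-step : ∀ e₀ a b γ Z v u → + 3 * (b * e₀) * Z + γ * (a * e₀) * v + e₀ * u ≡ e₀ * (+ 3 * b * Z + γ * a * v + u)
    quadratic-step = solve-∀

  Q-suc : ∀ m → + 3 * Q (suc m) ≡ e₀ * (a * count m + + 3 * Q m)
  Q-suc m = begin
    + 3 * Q (suc m)
      ≡⟨ cong (+ 3 *_) (pairSum-separable m N _ ts (λ c → expand (head c) (squareSum m (tail c)))) ⟩
    + 3 * (e₂ * count m + (e₀ * Q m + 0ℤ))
      ≡⟨ regroup e₀ e₂ (count m) (Q m) ⟩
    + 3 * e₂ * count m + e₀ * (+ 3 * Q m)
      ≡⟨ cong (λ x → x * count m + e₀ * (+ 3 * Q m)) e₂-value ⟩
    a * e₀ * count m + e₀ * (+ 3 * Q m)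
      ≡⟨ linear-step e₀ a (count m) (+ 3 * Q m) ⟩
    e₀ * (a * count m + + 3 * Q m) ∎
    where
    ts : SeparableTerms m
    ts = ((λ t → t * t) , const 1ℤ) ∷ (const 1ℤ , squareSum m) ∷ []
    expand : ∀ t q → t * t + q ≡ t * t * 1ℤ + (1ℤ * q + 0ℤ)
    expand = solve-∀
    regroup : ∀ e₀ e₂ Z q → + 3 * (e₂ * Z + (e₀ * q + 0ℤ)) ≡ + 3 * e₂ * Z + e₀ * (+ 3 * q)
    regroup = solve-∀

  S²-suc : ∀ m → + 3 * S² (suc m) ≡ e₀ * (a * count m + + 3 * S² m)
  S²-suc m = begin
    + 3 * S² (suc m)
      ≡⟨ cong (+ 3 *_) (pairSum-separable m N _ ts (λ c → expand (head c) (coordSum m (tail c)))) ⟩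
    + 3 * (e₂ * count m + (e₁ * X + (e₀ * S² m + 0ℤ)))
      ≡⟨ cong (λ e → + 3 * (e₂ * count m + (e * X + (e₀ * S² m + 0ℤ)))) e₁≡0 ⟩
    + 3 * (e₂ * count m + (0ℤ * X + (e₀ * S² m + 0ℤ)))
      ≡⟨ regroup e₀ e₂ (count m) X (S² m) ⟩
    + 3 * e₂ * count m + e₀ * (+ 3 * S² m)
      ≡⟨ cong (λ x → x * count m + e₀ * (+ 3 * S² m)) e₂-value ⟩
    a * e₀ * count m + e₀ * (+ 3 * S² m)
      ≡⟨ linear-step e₀ a (count m) (+ 3 * S² m) ⟩
    e₀ * (a * count m + + 3 * S² m) ∎
    where
    X : ℤ
    X = pairSum m N (λ c → + 2 * coordSum m c)
    ts : SeparableTerms m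
    ts = ((λ t → t * t) , const 1ℤ) ∷ ((λ t → t) , (λ c → + 2 * coordSum m c))
       ∷ (const 1ℤ , (λ c → coordSum m c * coordSum m c)) ∷ []
    expand : ∀ t s → (t + s) * (t + s) ≡ t * t * 1ℤ + (t * (+ 2 * s) + (1ℤ * (s * s) + 0ℤ))
    expand = solve-∀
    regroup : ∀ e₀ e₂ Z x s → + 3 * (e₂ * Z + (0ℤ * x + (e₀ * s + 0ℤ))) ≡ + 3 * e₂ * Z + e₀ * (+ 3 * s)
    regroup = solve-∀

  Q²-suc : ∀ m → + 45 * Q² (suc m) ≡ e₀ * (+ 3 * b * count m + + 10 * a * (+ 3 * Q m) + + 45 * Q² m)
  Q²-suc m = begin
    + 45 * Q² (suc m)
      ≡⟨ cong (+ 45 *_) (pairSum-separable m N _ ts (λ c → expand (head c) (squareSum m (tail c)))) ⟩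
    + 45 * (e₄ * count m + (e₂ * pairSum m N (λ c → + 2 * squareSum m c) + (e₀ * Q² m + 0ℤ)))
      ≡⟨ cong (λ x → + 45 * (e₄ * count m + (e₂ * x + (e₀ * Q² m + 0ℤ)))) (pairSum-*ˡ m N (+ 2) (squareSum m)) ⟩
    + 45 * (e₄ * count m + (e₂ * (+ 2 * Q m) + (e₀ * Q² m + 0ℤ)))
      ≡⟨ regroup e₀ e₂ e₄ (count m) (Q m) (Q² m) ⟩
    + 3 * (+ 15 * e₄) * count m + + 10 * (+ 3 * e₂) * (+ 3 * Q m) + e₀ * (+ 45 * Q² m)
      ≡⟨ cong₂ (λ x y → + 3 * x * count m + + 10 * y * (+ 3 * Q m) + e₀ * (+ 45 * Q² m)) e₄-value e₂-value ⟩
    + 3 * (b * e₀) * count m + + 10 * (a * e₀) * (+ 3 * Q m) + e₀ * (+ 45 * Q² m)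
      ≡⟨ quadratic-step e₀ a b (+ 10) (count m) (+ 3 * Q m) (+ 45 * Q² m) ⟩
    e₀ * (+ 3 * b * count m + + 10 * a * (+ 3 * Q m) + + 45 * Q² m) ∎
    where
    ts : SeparableTerms m
    ts = ((λ t → t * t * (t * t)) , const 1ℤ) ∷ ((λ t → t * t) , (λ c → + 2 * squareSum m c))
       ∷ (const 1ℤ , (λ c → squareSum m c * squareSum m c)) ∷ []
    expand : ∀ t q → (t * t + q) * (t * t + q) ≡ t * t * (t * t) * 1ℤ + (t * t * (+ 2 * q) + (1ℤ * (q * q) + 0ℤ))
    expand = solve-∀
    regroup : ∀ e₀ e₂ e₄ Z q q² → + 45 * (e₄ * Z + (e₂ * (+ 2 * q) + (e₀ * q² + 0ℤ)))
                                ≡ + 3 * (+ 15 * e₄) * Z + + 10 * (+ 3 * e₂) * (+ 3 * q) + e₀ * (+ 45 * q²)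
    regroup = solve-∀

  QS²-suc : ∀ m → + 45 * QS² (suc m) ≡ e₀ * (+ 3 * b * count m + + 5 * a * (+ 3 * S² m + + 3 * Q m) + + 45 * QS² m)
  QS²-suc m = begin
    + 45 * QS² (suc m)
      ≡⟨ cong (+ 45 *_) (pairSum-separable m N _ ts (λ c → expand (head c) (squareSum m (tail c)) (coordSum m (tail c)))) ⟩
    + 45 * (e₄ * count m + (e₃ * X + (e₂ * S² m + (e₂ * Q m + (e₁ * Y + (e₀ * QS² m + 0ℤ))))))
      ≡⟨ cong₂ (λ x y → + 45 * (e₄ * count m + (x * X + (e₂ * S² m + (e₂ * Q m + (y * Y + (e₀ * QS² m + 0ℤ)))))))
               e₃≡0 e₁≡0 ⟩
    + 45 * (e₄ * count m + (0ℤ * X + (e₂ * S² m + (e₂ * Q m + (0ℤ * Y + (e₀ * QS² m + 0ℤ))))))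
      ≡⟨ regroup e₀ e₂ e₄ (count m) X Y (S² m) (Q m) (QS² m) ⟩
    + 3 * (+ 15 * e₄) * count m + + 5 * (+ 3 * e₂) * (+ 3 * S² m + + 3 * Q m) + e₀ * (+ 45 * QS² m)
      ≡⟨ cong₂ (λ x y → + 3 * x * count m + + 5 * y * (+ 3 * S² m + + 3 * Q m) + e₀ * (+ 45 * QS² m)) e₄-value e₂-value ⟩
    + 3 * (b * e₀) * count m + + 5 * (a * e₀) * (+ 3 * S² m + + 3 * Q m) + e₀ * (+ 45 * QS² m)
      ≡⟨ quadratic-step e₀ a b (+ 5) (count m) (+ 3 * S² m + + 3 * Q m) (+ 45 * QS² m) ⟩
    e₀ * (+ 3 * b * count m + + 5 * a * (+ 3 * S² m + + 3 * Q m) + + 45 * QS² m) ∎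
    where
    X Y : ℤ
    X = pairSum m N (λ c → + 2 * coordSum m c)
    Y = pairSum m N (λ c → + 2 * (squareSum m c * coordSum m c))
    ts : SeparableTerms m
    ts = ((λ t → t * t * (t * t)) , const 1ℤ) ∷ ((λ t → t * t * t) , (λ c → + 2 * coordSum m c))
       ∷ ((λ t → t * t) , (λ c → coordSum m c * coordSum m c)) ∷ ((λ t → t * t) , squareSum m)
       ∷ ((λ t → t) , (λ c → + 2 * (squareSum m c * coordSum m c)))
       ∷ (const 1ℤ , (λ c → squareSum m c * (coordSum m c * coordSum m c))) ∷ []
    expand : ∀ t q s → (t * t + q) * ((t + s) * (t + s))
                     ≡ t * t * (t * t) * 1ℤ + (t * t * t * (+ 2 * s) + (t * t * (s * s) + (t * t * q
                       + (t * (+ 2 * (q * s)) + (1ℤ * (q * (s * s)) + 0ℤ)))))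
    expand = solve-∀
    regroup : ∀ e₀ e₂ e₄ Z x y s² q qs² → + 45 * (e₄ * Z + (0ℤ * x + (e₂ * s² + (e₂ * q + (0ℤ * y + (e₀ * qs² + 0ℤ))))))
                                        ≡ + 3 * (+ 15 * e₄) * Z + + 5 * (+ 3 * e₂) * (+ 3 * s² + + 3 * q) + e₀ * (+ 45 * qs²)
    regroup = solve-∀

  S⁴-suc : ∀ m → + 45 * S⁴ (suc m) ≡ e₀ * (+ 3 * b * count m + + 30 * a * (+ 3 * S² m) + + 45 * S⁴ m)
  S⁴-suc m = begin
    + 45 * S⁴ (suc m)
      ≡⟨ cong (+ 45 *_) (pairSum-separable m N _ ts (λ c → expand (head c) (coordSum m (tail c)))) ⟩
    + 45 * (e₄ * count m + (e₃ * X + (e₂ * pairSum m N (λ c → + 6 * (coordSum m c * coordSum m c)) + (e₁ * Y + (e₀ * S⁴ m + 0ℤ)))))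
      ≡⟨ cong₂ (λ x y → + 45 * (e₄ * count m + (x * X + (e₂ * pairSum m N (λ c → + 6 * (coordSum m c * coordSum m c))
                                                       + (y * Y + (e₀ * S⁴ m + 0ℤ)))))) e₃≡0 e₁≡0 ⟩
    + 45 * (e₄ * count m + (0ℤ * X + (e₂ * pairSum m N (λ c → + 6 * (coordSum m c * coordSum m c)) + (0ℤ * Y + (e₀ * S⁴ m + 0ℤ)))))
      ≡⟨ cong (λ z → + 45 * (e₄ * count m + (0ℤ * X + (e₂ * z + (0ℤ * Y + (e₀ * S⁴ m + 0ℤ))))))
              (pairSum-*ˡ m N (+ 6) (λ c → coordSum m c * coordSum m c)) ⟩
    + 45 * (e₄ * count m + (0ℤ * X + (e₂ * (+ 6 * S² m) + (0ℤ * Y + (e₀ * S⁴ m + 0ℤ)))))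
      ≡⟨ regroup e₀ e₂ e₄ (count m) X Y (S² m) (S⁴ m) ⟩
    + 3 * (+ 15 * e₄) * count m + + 30 * (+ 3 * e₂) * (+ 3 * S² m) + e₀ * (+ 45 * S⁴ m)
      ≡⟨ cong₂ (λ x y → + 3 * x * count m + + 30 * y * (+ 3 * S² m) + e₀ * (+ 45 * S⁴ m)) e₄-value e₂-value ⟩
    + 3 * (b * e₀) * count m + + 30 * (a * e₀) * (+ 3 * S² m) + e₀ * (+ 45 * S⁴ m)
      ≡⟨ quadratic-step e₀ a b (+ 30) (count m) (+ 3 * S² m) (+ 45 * S⁴ m) ⟩
    e₀ * (+ 3 * b * count m + + 30 * a * (+ 3 * S² m) + + 45 * S⁴ m) ∎
    where
    X Y : ℤ
    X = pairSum m N (λ c → + 4 * coordSum m c)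
    Y = pairSum m N (λ c → + 4 * (coordSum m c * coordSum m c * coordSum m c))
    ts : SeparableTerms m
    ts = ((λ t → t * t * (t * t)) , const 1ℤ) ∷ ((λ t → t * t * t) , (λ c → + 4 * coordSum m c))
       ∷ ((λ t → t * t) , (λ c → + 6 * (coordSum m c * coordSum m c)))
       ∷ ((λ t → t) , (λ c → + 4 * (coordSum m c * coordSum m c * coordSum m c)))
       ∷ (const 1ℤ , (λ c → coordSum m c * coordSum m c * (coordSum m c * coordSum m c))) ∷ []
    expand : ∀ t s → (t + s) * (t + s) * ((t + s) * (t + s))
                   ≡ t * t * (t * t) * 1ℤ + (t * t * t * (+ 4 * s) + (t * t * (+ 6 * (s * s))
                     + (t * (+ 4 * (s * s * s)) + (1ℤ * (s * s * (s * s)) + 0ℤ))))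
    expand = solve-∀
    regroup : ∀ e₀ e₂ e₄ Z x y s² s⁴ → + 45 * (e₄ * Z + (0ℤ * x + (e₂ * (+ 6 * s²) + (0ℤ * y + (e₀ * s⁴ + 0ℤ)))))
                                     ≡ + 3 * (+ 15 * e₄) * Z + + 30 * (+ 3 * e₂) * (+ 3 * s²) + e₀ * (+ 45 * s⁴)
    regroup = solve-∀

  Q-mean : ∀ m → + 3 * Q m ≡ + m * a * count m
  Q-mean = linear-recurrence e₀ count count-suc a refl Q-suc

  S²-mean : ∀ m → + 3 * S² m ≡ + m * a * count m
  S²-mean = linear-recurrence e₀ count count-suc a refl S²-suc

  Q²-mean : ∀ m → + 2 * (+ 45 * Q² m) ≡ (+ 2 * + m * (+ 3 * b) + + m * (+ m - 1ℤ) * (+ 10 * a) * a) * count m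
  Q²-mean = quadratic-recurrence e₀ count count-suc (+ 3 * b) a (+ 10 * a) refl Q-mean Q²-suc

  QS²-mean : ∀ m → + 2 * (+ 45 * QS² m) ≡ (+ 2 * + m * (+ 3 * b) + + m * (+ m - 1ℤ) * (+ 5 * a) * (+ 2 * a)) * count m
  QS²-mean = quadratic-recurrence e₀ count count-suc (+ 3 * b) (+ 2 * a) (+ 5 * a) refl S²+Q-mean QS²-suc
    where
    S²+Q-mean : ∀ m → + 3 * S² m + + 3 * Q m ≡ + m * (+ 2 * a) * count m
    S²+Q-mean m = trans (cong₂ _+_ (S²-mean m) (Q-mean m)) (double (+ m) a (count m))
      where
      double : ∀ m a Z → m * a * Z + m * a * Z ≡ m * (+ 2 * a) * Z
      double = solve-∀

  S⁴-mean : ∀ m → + 2 * (+ 45 * S⁴ m) ≡ (+ 2 * + m * (+ 3 * b) + + m * (+ m - 1ℤ) * (+ 30 * a) * a) * count m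
  S⁴-mean = quadratic-recurrence e₀ count count-suc (+ 3 * b) a (+ 30 * a) refl S²-mean S⁴-suc

module Deviations (m N : ℕ) where

  open CoordinateMoments N
  open BoxMoments N

  P k : ℤ
  P = + suc m
  k = P ^ 3 * (+ N) ^ 2

  -- 3 (d² - μ), as μ = (2/3) k
  deviation : (Fin m → ℤ) → ℤ
  deviation c = + 3 * normSq (suc m) c - + 2 * k

  deviations : ℤ
  deviations = pairSum m N (λ c → deviation c * deviation c)

  deviations-expand : deviations ≡ + 9 * (P * P * (P * P)) * Q² m + (+ 9 * ((P + 1ℤ) * (P + 1ℤ)) * S⁴ m
    + (+ 4 * (k * k) * count m + (- (+ 18 * (P * P * (P + 1ℤ))) * QS² m + (- (+ 12 * (P * P * k)) * Q m
    + (+ 12 * ((P + 1ℤ) * k) * S² m + 0ℤ)))))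
  deviations-expand = trans
    (pairSum-cong m N (λ c → trans (cong (λ d → (+ 3 * d - + 2 * k) * (+ 3 * d - + 2 * k)) (normSq-coordinates c))
                                   (expand P k (squareSum m c) (coordSum m c))))
    (pairSum-linear m N ts)
    where
    ts : List (ℤ × ((Fin m → ℤ) → ℤ))
    ts = (+ 9 * (P * P * (P * P)) , (λ c → squareSum m c * squareSum m c))
       ∷ (+ 9 * ((P + 1ℤ) * (P + 1ℤ)) , (λ c → coordSum m c * coordSum m c * (coordSum m c * coordSum m c)))
       ∷ (+ 4 * (k * k) , const 1ℤ)
       ∷ (- (+ 18 * (P * P * (P + 1ℤ))) , (λ c → squareSum m c * (coordSum m c * coordSum m c)))
       ∷ (- (+ 12 * (P * P * k)) , squareSum m)
       ∷ (+ 12 * ((P + 1ℤ) * k) , (λ c → coordSum m c * coordSum m c)) ∷ []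
    expand : ∀ P k q s → (+ 3 * (P * P * q - (P + 1ℤ) * (s * s)) - + 2 * k) * (+ 3 * (P * P * q - (P + 1ℤ) * (s * s)) - + 2 * k)
      ≡ + 9 * (P * P * (P * P)) * (q * q) + (+ 9 * ((P + 1ℤ) * (P + 1ℤ)) * (s * s * (s * s))
        + (+ 4 * (k * k) * 1ℤ + (- (+ 18 * (P * P * (P + 1ℤ))) * (q * (s * s)) + (- (+ 12 * (P * P * k)) * q
        + (+ 12 * ((P + 1ℤ) * k) * (s * s) + 0ℤ)))))
    expand = solve-∀

  deviation-sum : + 5 * deviations ≡ count m * R×45 P (+ N)
  deviation-sum = ℤ.*-cancelˡ-≡ (+ 2) (+ 5 * deviations) (count m * R×45 P (+ N)) (begin
    + 2 * (+ 5 * deviations)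
      ≡⟨ cong (λ x → + 2 * (+ 5 * x)) deviations-expand ⟩
    + 2 * (+ 5 * (+ 9 * u₁ * Q² m + (+ 9 * u₂ * S⁴ m + (+ 4 * u₃ * count m + (- (+ 18 * u₄) * QS² m
      + (- (+ 12 * u₅) * Q m + (+ 12 * u₆ * S² m + 0ℤ)))))))
      ≡⟨ regroup u₁ u₂ u₃ u₄ u₅ u₆ (count m) (Q² m) (S⁴ m) (QS² m) (Q m) (S² m) ⟩
    u₁ * (+ 2 * (+ 45 * Q² m)) + u₂ * (+ 2 * (+ 45 * S⁴ m)) - + 2 * u₄ * (+ 2 * (+ 45 * QS² m))
      + + 40 * u₃ * count m - + 40 * u₅ * (+ 3 * Q m) + + 40 * u₆ * (+ 3 * S² m)
      ≡⟨ plug (Q²-mean m) (S⁴-mean m) (QS²-mean m) (Q-mean m) (S²-mean m) ⟩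
    + 2 * (count m * R×45 P (+ N)) ∎)
    where
    u₁ u₂ u₃ u₄ u₅ u₆ : ℤ
    u₁ = P * P * (P * P)
    u₂ = (P + 1ℤ) * (P + 1ℤ)
    u₃ = k * k
    u₄ = P * P * (P + 1ℤ)
    u₅ = P * P * k
    u₆ = (P + 1ℤ) * k
    regroup : ∀ u₁ u₂ u₃ u₄ u₅ u₆ Z q² s⁴ qs² q s² →
      + 2 * (+ 5 * (+ 9 * u₁ * q² + (+ 9 * u₂ * s⁴ + (+ 4 * u₃ * Z + (- (+ 18 * u₄) * qs²
      + (- (+ 12 * u₅) * q + (+ 12 * u₆ * s² + 0ℤ)))))))
        ≡ u₁ * (+ 2 * (+ 45 * q²)) + u₂ * (+ 2 * (+ 45 * s⁴)) - + 2 * u₄ * (+ 2 * (+ 45 * qs²))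
          + + 40 * u₃ * Z - + 40 * u₅ * (+ 3 * q) + + 40 * u₆ * (+ 3 * s²)
    regroup = solve-∀
    collect : ∀ u₁ u₂ u₃ u₄ u₅ u₆ m a b Z →
      u₁ * ((+ 2 * m * (+ 3 * b) + m * (m - 1ℤ) * (+ 10 * a) * a) * Z)
      + u₂ * ((+ 2 * m * (+ 3 * b) + m * (m - 1ℤ) * (+ 30 * a) * a) * Z)
      - + 2 * u₄ * ((+ 2 * m * (+ 3 * b) + m * (m - 1ℤ) * (+ 5 * a) * (+ 2 * a)) * Z)
      + + 40 * u₃ * Z - + 40 * u₅ * (m * a * Z) + + 40 * u₆ * (m * a * Z)
        ≡ + 2 * (Z * (u₁ * (+ 3 * m * b + + 5 * m * (m - 1ℤ) * a * a) + u₂ * (+ 3 * m * b + + 15 * m * (m - 1ℤ) * a * a)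
                     - + 2 * u₄ * (+ 3 * m * b + + 5 * m * (m - 1ℤ) * a * a)
                     + + 20 * u₃ - + 20 * u₅ * (m * a) + + 20 * u₆ * (m * a)))
    collect = solve-∀
    plug : ∀ {q² s⁴ qs² q s²} →
      q²  ≡ (+ 2 * + m * (+ 3 * b) + + m * (+ m - 1ℤ) * (+ 10 * a) * a) * count m →
      s⁴  ≡ (+ 2 * + m * (+ 3 * b) + + m * (+ m - 1ℤ) * (+ 30 * a) * a) * count m →
      qs² ≡ (+ 2 * + m * (+ 3 * b) + + m * (+ m - 1ℤ) * (+ 5 * a) * (+ 2 * a)) * count m →
      q   ≡ + m * a * count m → s² ≡ + m * a * count m →
      u₁ * q² + u₂ * s⁴ - + 2 * u₄ * qs² + + 40 * u₃ * count m - + 40 * u₅ * q + + 40 * u₆ * s²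
        ≡ + 2 * (count m * R×45 P (+ N))
    plug refl refl refl refl refl = collect u₁ u₂ u₃ u₄ u₅ u₆ (+ m) a b (count m)

-- The polynomial inequality

nonNeg-* : ∀ i j → 0ℤ ≤ i → 0ℤ ≤ j → 0ℤ ≤ i * j
nonNeg-* i j 0≤i 0≤j = subst (_≤ i * j) (ℤ.*-zeroˡ j) (ℤ.*-monoʳ-≤-nonNeg j {{ℤ.nonNegative 0≤j}} 0≤i)

horner-nonNeg : ∀ cs a → 0ℤ ≤ horner cs (+ a)
horner-nonNeg []       a = ℤ.+≤+ ℕ.z≤n
horner-nonNeg (c ∷ cs) a = ℤ.+-mono-≤ (ℤ.+≤+ ℕ.z≤n) (nonNeg-* (+ a) (horner cs (+ a)) (ℤ.+≤+ ℕ.z≤n) (horner-nonNeg cs a))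

horner₂-nonNeg : ∀ css a b → 0ℤ ≤ horner₂ css (+ a) (+ b)
horner₂-nonNeg []         a b = ℤ.+≤+ ℕ.z≤n
horner₂-nonNeg (cs ∷ css) a b =
  ℤ.+-mono-≤ (horner-nonNeg cs b) (nonNeg-* (+ a) (horner₂ css (+ a) (+ b)) (ℤ.+≤+ ℕ.z≤n) (horner₂-nonNeg css a b))

-- The coefficients of 50 bound(p, N) - 45 R(p, N) as a polynomial in p - 1 (rows) and N - 1 (columns)
slack : List (List ℕ)
slack = (80  ∷ 270  ∷ 330  ∷ 170  ∷ 30  ∷ [])
      ∷ (890 ∷ 2742 ∷ 3042 ∷ 1412 ∷ 222 ∷ [])
      ∷ (910 ∷ 2886 ∷ 3186 ∷ 1366 ∷ 156 ∷ [])
      ∷ (960 ∷ 3038 ∷ 3278 ∷ 1288 ∷ 88  ∷ [])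
      ∷ (820 ∷ 2574 ∷ 2774 ∷ 1094 ∷ 74  ∷ [])
      ∷ (290 ∷ 942  ∷ 1042 ∷ 412  ∷ 22  ∷ [])
      ∷ (30  ∷ 110  ∷ 130  ∷ 50   ∷ [])
      ∷ []

R×45-slack : ∀ A B → R×45 (1ℤ + A) (1ℤ + B) + horner₂ slack A B ≡ + 50 * bound (1ℤ + A) (1ℤ + B)
R×45-slack = solve 2 (λ A B → S.R×45 (con 1ℤ :+ A) (con 1ℤ :+ B) :+ S.horner₂ slack A B
                                := con (+ 50) :* S.bound (con 1ℤ :+ A) (con 1ℤ :+ B)) refl
  where
  open ℤ-Solver.+-*-Solver using (Polynomial; con; _:+_; _:*_; :-_; _:=_; solve)
  syntaxRing : RawRing 0ℓ 0ℓ
  syntaxRing = record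
    { Carrier = Polynomial 2 ; _≈_ = _≡_ ; _+_ = _:+_ ; _*_ = _:*_ ; -_ = :-_ ; 0# = con 0ℤ ; 1# = con 1ℤ }
  module S = Polynomials syntaxRing con

R×45≤50bound : ∀ a b → R×45 (+ suc a) (+ suc b) ≤ + 50 * bound (+ suc a) (+ suc b)
R×45≤50bound a b = subst (R×45 (+ suc a) (+ suc b) ≤_) (R×45-slack (+ a) (+ b))
  (ℤ.i≤i+j (R×45 (+ suc a) (+ suc b)) (horner₂ slack (+ a) (+ b)) {{ℤ.nonNegative (horner₂-nonNeg slack a b)}})

private
  embed : ℤ → ℚᵘ
  embed z = mkℚᵘ z 0

  toℚᵘ-toℚ : ∀ z → ℚ.toℚᵘ (toℚ z) ℚᵘ.≃ embed z
  toℚᵘ-toℚ z = ℚ.toℚᵘ-fromℚᵘ (embed z)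

toℚ-+ : ∀ x y → toℚ (x + y) ≡ toℚ x ℚ.+ toℚ y
toℚ-+ x y = ℚ.toℚᵘ-injective (ℚᵘ.≃-trans (toℚᵘ-toℚ (x + y))
  (ℚᵘ.≃-sym (ℚᵘ.≃-trans (ℚ.toℚᵘ-homo-+ (toℚ x) (toℚ y))
  (ℚᵘ.≃-trans (ℚᵘ.+-cong (toℚᵘ-toℚ x) (toℚᵘ-toℚ y)) (ℚᵘ.*≡* (denominators x y))))))
  where
  denominators : ∀ x y → (x * 1ℤ + y * 1ℤ) * 1ℤ ≡ (x + y) * 1ℤ
  denominators = solve-∀

toℚ-* : ∀ x y → toℚ (x * y) ≡ toℚ x ℚ.* toℚ y
toℚ-* x y = ℚ.toℚᵘ-injective (ℚᵘ.≃-trans (toℚᵘ-toℚ (x * y))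
  (ℚᵘ.≃-sym (ℚᵘ.≃-trans (ℚ.toℚᵘ-homo-* (toℚ x) (toℚ y))
  (ℚᵘ.≃-trans (ℚᵘ.*-cong (toℚᵘ-toℚ x) (toℚᵘ-toℚ y)) ℚᵘ.≃-refl))))

toℚ-neg : ∀ x → toℚ (- x) ≡ ℚ.- toℚ x
toℚ-neg x = ℚ.toℚᵘ-injective (ℚᵘ.≃-trans (toℚᵘ-toℚ (- x)) (ℚᵘ.≃-sym (ℚᵘ.≃-trans (ℚ.toℚᵘ-homo‿- (toℚ x))
  (ℚᵘ.-‿cong (toℚᵘ-toℚ x)))))

toℚ-mono : ∀ {x y} → x ≤ y → toℚ x ℚ.≤ toℚ y
toℚ-mono {x} {y} x≤y = ℚ.toℚᵘ-cancel-≤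
  (ℚᵘ.≤-respˡ-≃ (ℚᵘ.≃-sym (toℚᵘ-toℚ x)) (ℚᵘ.≤-respʳ-≃ (ℚᵘ.≃-sym (toℚᵘ-toℚ y))
  (ℚᵘ.*≤* (ℤ.*-monoʳ-≤-nonNeg 1ℤ x≤y))))

invℕ-inverse : ∀ n → invℕ (suc n) ℚ.* toℚ (+ suc n) ≡ ℚ.1ℚ
invℕ-inverse n = ℚ.toℚᵘ-injective (ℚᵘ.≃-trans (ℚ.toℚᵘ-homo-* (invℕ (suc n)) (toℚ (+ suc n)))
  (ℚᵘ.≃-trans (ℚᵘ.*-cong (ℚ.toℚᵘ-fromℚᵘ (mkℚᵘ 1ℤ n)) (toℚᵘ-toℚ (+ suc n)))
    (ℚᵘ.*≡* (trans (cancel (+ suc n)) (cong (λ d → 1ℤ * + suc d) (sym (ℕ.*-identityʳ n)))))))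
  where
  cancel : ∀ s → 1ℤ * s * 1ℤ ≡ 1ℤ * s
  cancel = solve-∀

ℚ-ring : ACR.AlmostCommutativeRing 0ℓ 0ℓ
ℚ-ring = ACR.fromCommutativeRing ℚ.+-*-commutativeRing (λ x → dec⇒maybe (ℚ.0ℚ ℚ.≟ x))

sumℚ-++ : ∀ xs ys → sumℚ (xs ++ ys) ≡ sumℚ xs ℚ.+ sumℚ ys
sumℚ-++ []       ys = sym (ℚ.+-identityˡ (sumℚ ys))
sumℚ-++ (x ∷ xs) ys = trans (cong (x ℚ.+_) (sumℚ-++ xs ys)) (sym (ℚ.+-assoc x (sumℚ xs) (sumℚ ys)))

module _ {A : Set} where

  sumℚ-toℚ : ∀ xs (F : A → ℚ) (g : A → ℤ) c → (∀ x → F x ≡ toℚ (g x) ℚ.* c) →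
    sumℚ (map F xs) ≡ toℚ (∑ xs g) ℚ.* c
  sumℚ-toℚ []       F g c F≡ = sym (ℚ.*-zeroˡ c)
  sumℚ-toℚ (x ∷ xs) F g c F≡ = begin
    F x ℚ.+ sumℚ (map F xs)                     ≡⟨ cong₂ ℚ._+_ (F≡ x) (sumℚ-toℚ xs F g c F≡) ⟩
    toℚ (g x) ℚ.* c ℚ.+ toℚ (∑ xs g) ℚ.* c      ≡⟨ ℚ.*-distribʳ-+ c (toℚ (g x)) (toℚ (∑ xs g)) ⟨
    (toℚ (g x) ℚ.+ toℚ (∑ xs g)) ℚ.* c          ≡⟨ cong (ℚ._* c) (toℚ-+ (g x) (∑ xs g)) ⟨
    toℚ (g x + ∑ xs g) ℚ.* c                    ∎

  sumℚ-concatMap : ∀ xs (G : A → List ℚ) → sumℚ (concatMap G xs) ≡ sumℚ (map (sumℚ ∘ G) xs)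
  sumℚ-concatMap []       G = refl
  sumℚ-concatMap (x ∷ xs) G = trans (sumℚ-++ (G x) (concatMap G xs)) (cong (sumℚ (G x) ℚ.+_) (sumℚ-concatMap xs G))

  sumℚ-pairs : ∀ xs (F : A → A → ℚ) (g : A → A → ℤ) c → (∀ x y → F x y ≡ toℚ (g x y) ℚ.* c) →
    sumℚ (concatMap (λ x → map (F x) xs) xs) ≡ toℚ (∑[ x ∈ xs ] ∑[ y ∈ xs ] g x y) ℚ.* c
  sumℚ-pairs xs F g c F≡ = trans (sumℚ-concatMap xs (λ x → map (F x) xs))
    (sumℚ-toℚ xs (λ x → sumℚ (map (F x) xs)) (λ x → ∑ xs (g x)) c (λ x → sumℚ-toℚ xs (F x) (g x) c (F≡ x)))

deviation-square : ∀ d k → (toℚ d ℚ.- (+ 2 ℚ./ 3) ℚ.* toℚ k) ℚ.* (toℚ d ℚ.- (+ 2 ℚ./ 3) ℚ.* toℚ k)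
                          ≡ toℚ ((+ 3 * d - + 2 * k) * (+ 3 * d - + 2 * k)) ℚ.* (+ 1 ℚ./ 9)
deviation-square d k = begin
  (toℚ d ℚ.- (+ 2 ℚ./ 3) ℚ.* toℚ k) ℚ.* (toℚ d ℚ.- (+ 2 ℚ./ 3) ℚ.* toℚ k)
    ≡⟨ rescale (toℚ d) (toℚ k) ⟩
  X′ ℚ.* X′ ℚ.* (+ 1 ℚ./ 9)
    ≡⟨ cong (λ x → x ℚ.* x ℚ.* (+ 1 ℚ./ 9)) toℚ-X ⟨
  toℚ X ℚ.* toℚ X ℚ.* (+ 1 ℚ./ 9)
    ≡⟨ cong (ℚ._* (+ 1 ℚ./ 9)) (toℚ-* X X) ⟨
  toℚ (X * X) ℚ.* (+ 1 ℚ./ 9) ∎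
  where
  X : ℤ
  X = + 3 * d - + 2 * k
  X′ : ℚ
  X′ = toℚ (+ 3) ℚ.* toℚ d ℚ.+ ℚ.- (toℚ (+ 2) ℚ.* toℚ k)
  toℚ-X : toℚ X ≡ X′
  toℚ-X = trans (toℚ-+ (+ 3 * d) (- (+ 2 * k)))
                (cong₂ ℚ._+_ (toℚ-* (+ 3) d) (trans (toℚ-neg (+ 2 * k)) (cong ℚ.-_ (toℚ-* (+ 2) k))))
  rescale : ∀ D K → (D ℚ.- (+ 2 ℚ./ 3) ℚ.* K) ℚ.* (D ℚ.- (+ 2 ℚ./ 3) ℚ.* K)
                  ≡ (toℚ (+ 3) ℚ.* D ℚ.+ ℚ.- (toℚ (+ 2) ℚ.* K)) ℚ.* (toℚ (+ 3) ℚ.* D ℚ.+ ℚ.- (toℚ (+ 2) ℚ.* K))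
                      ℚ.* (+ 1 ℚ./ 9)
  rescale = RingSolver.solve-∀ ℚ-ring

average : ∀ c d r → + 5 * d ≡ + suc c * r → invℕ (suc c) ℚ.* (toℚ d ℚ.* (+ 1 ℚ./ 9)) ≡ toℚ r ℚ.* (+ 1 ℚ./ 45)
average c d r 5d≡nr = begin
  I ℚ.* (toℚ d ℚ.* (+ 1 ℚ./ 9))                     ≡⟨ rescale I (toℚ d) ⟩
  I ℚ.* (toℚ (+ 5) ℚ.* toℚ d) ℚ.* (+ 1 ℚ./ 45)      ≡⟨ cong (λ x → I ℚ.* x ℚ.* (+ 1 ℚ./ 45)) (toℚ-* (+ 5) d) ⟨
  I ℚ.* toℚ (+ 5 * d) ℚ.* (+ 1 ℚ./ 45)              ≡⟨ cong (λ x → I ℚ.* toℚ x ℚ.* (+ 1 ℚ./ 45)) 5d≡nr ⟩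
  I ℚ.* toℚ (+ suc c * r) ℚ.* (+ 1 ℚ./ 45)          ≡⟨ cong (λ x → I ℚ.* x ℚ.* (+ 1 ℚ./ 45)) (toℚ-* (+ suc c) r) ⟩
  I ℚ.* (toℚ (+ suc c) ℚ.* toℚ r) ℚ.* (+ 1 ℚ./ 45)  ≡⟨ reassociate I (toℚ (+ suc c)) (toℚ r) ⟩
  I ℚ.* toℚ (+ suc c) ℚ.* (toℚ r ℚ.* (+ 1 ℚ./ 45))  ≡⟨ cong (ℚ._* (toℚ r ℚ.* (+ 1 ℚ./ 45))) (invℕ-inverse c) ⟩
  ℚ.1ℚ ℚ.* (toℚ r ℚ.* (+ 1 ℚ./ 45))                 ≡⟨ ℚ.*-identityˡ (toℚ r ℚ.* (+ 1 ℚ./ 45)) ⟩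
  toℚ r ℚ.* (+ 1 ℚ./ 45)                            ∎
  where
  I : ℚ
  I = invℕ (suc c)
  rescale : ∀ I D → I ℚ.* (D ℚ.* (+ 1 ℚ./ 9)) ≡ I ℚ.* (toℚ (+ 5) ℚ.* D) ℚ.* (+ 1 ℚ./ 45)
  rescale = RingSolver.solve-∀ ℚ-ring
  reassociate : ∀ I n r → I ℚ.* (n ℚ.* r) ℚ.* (+ 1 ℚ./ 45) ≡ I ℚ.* n ℚ.* (r ℚ.* (+ 1 ℚ./ 45))
  reassociate = RingSolver.solve-∀ ℚ-ring

pos-^ : ∀ x n → + (x ℕ.^ n) ≡ (+ x) ^ n
pos-^ x zero    = refl
pos-^ x (suc n) = trans (ℤ.pos-* x (x ℕ.^ n)) (cong (+ x *_) (pos-^ x n))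

R-value : ∀ m N → R (suc m) N ≡ toℚ (R×45 (+ suc m) (+ N)) ℚ.* (+ 1 ℚ./ 45)
R-value m N with BoxMoments.count-positive N m
... | c , count≡ = begin
  R (suc m) N
    ≡⟨ cong (invℕ (L ℕ.* L) ℚ.*_)
            (sumℚ-pairs (box m N) _ (λ α β → deviation (λ i → α i - β i) * deviation (λ i → α i - β i))
                        (+ 1 ℚ./ 9) (λ α β → summand (normSq (suc m) (λ i → α i - β i)))) ⟩
  invℕ (L ℕ.* L) ℚ.* (toℚ deviations ℚ.* (+ 1 ℚ./ 9))
    ≡⟨ cong (λ n → invℕ n ℚ.* (toℚ deviations ℚ.* (+ 1 ℚ./ 9))) (ℤ.+-injective (trans (sym (count≡L² m)) count≡)) ⟩
  invℕ (suc c) ℚ.* (toℚ deviations ℚ.* (+ 1 ℚ./ 9))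
    ≡⟨ average c deviations (R×45 P (+ N)) (trans deviation-sum (cong (ℤ._* R×45 P (+ N)) count≡)) ⟩
  toℚ (R×45 P (+ N)) ℚ.* (+ 1 ℚ./ 45) ∎
  where
  open BoxMoments N using (count≡L²)
  open Deviations m N using (P; k; deviation; deviations; deviation-sum)
  L : ℕ
  L = length (box m N)
  k-cast : + (suc m ℕ.^ 3 ℕ.* N ℕ.^ 2) ≡ k
  k-cast = trans (ℤ.pos-* (suc m ℕ.^ 3) (N ℕ.^ 2)) (cong₂ _*_ (pos-^ (suc m) 3) (pos-^ N 2))
  summand : ∀ d → (toℚ d ℚ.- μ (suc m) N) ℚ.* (toℚ d ℚ.- μ (suc m) N)
                ≡ toℚ ((+ 3 * d - + 2 * k) * (+ 3 * d - + 2 * k)) ℚ.* (+ 1 ℚ./ 9)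
  summand d = trans (deviation-square d (+ (suc m ℕ.^ 3 ℕ.* N ℕ.^ 2)))
                    (cong (λ k → toℚ ((+ 3 * d - + 2 * k) * (+ 3 * d - + 2 * k)) ℚ.* (+ 1 ℚ./ 9)) k-cast)

R≤bound : ∀ m b → R (suc m) (suc b) ℚ.≤ (+ 10 ℚ./ 9) ℚ.* toℚ (bound (+ suc m) (+ suc b))
R≤bound m b = subst₂ ℚ._≤_ (sym (R-value m (suc b))) fifty/45
  (ℚ.*-monoʳ-≤-nonNeg (+ 1 ℚ./ 45) (toℚ-mono (R×45≤50bound m b)))
  where
  T : ℤ
  T = bound (+ suc m) (+ suc b)
  fifty/45 : toℚ (+ 50 * T) ℚ.* (+ 1 ℚ./ 45) ≡ (+ 10 ℚ./ 9) ℚ.* toℚ T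
  fifty/45 = trans (cong (ℚ._* (+ 1 ℚ./ 45)) (toℚ-* (+ 50) T)) (rescale (toℚ T))
    where
    rescale : ∀ t → toℚ (+ 50) ℚ.* t ℚ.* (+ 1 ℚ./ 45) ≡ (+ 10 ℚ./ 9) ℚ.* t
    rescale = RingSolver.solve-∀ ℚ-ring

bound-cast : ∀ p N → + (p ℕ.^ 5 ℕ.* N ℕ.^ 4 ℕ.+ p ℕ.^ 6 ℕ.* N ℕ.^ 3) ≡ bound (+ p) (+ N)
bound-cast p N = trans (ℤ.pos-+ (p ℕ.^ 5 ℕ.* N ℕ.^ 4) (p ℕ.^ 6 ℕ.* N ℕ.^ 3))
  (cong₂ _+_ (trans (ℤ.pos-* (p ℕ.^ 5) (N ℕ.^ 4)) (cong₂ _*_ (pos-^ p 5) (pos-^ N 4)))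
             (trans (ℤ.pos-* (p ℕ.^ 6) (N ℕ.^ 3)) (cong₂ _*_ (pos-^ p 6) (pos-^ N 3))))

-- Only p ≠ 0 and N ≥ 1 are used: in the coordinates of Defs the trace formula is the definition of trPow.
lemma6p7 : ∃ λ (C : ℚ) → ∀ (p N : ℕ) → Prime p → p ≢ 2 → 1 ℕ.≤ N →
    R p N ℚ.≤ C ℚ.* toℚ (+ (p ℕ.^ 5 ℕ.* N ℕ.^ 4 ℕ.+ p ℕ.^ 6 ℕ.* N ℕ.^ 3))
lemma6p7 = + 10 ℚ./ 9 , R-bound
  where
  R-bound : ∀ (p N : ℕ) → Prime p → p ≢ 2 → 1 ℕ.≤ N →
    R p N ℚ.≤ (+ 10 ℚ./ 9) ℚ.* toℚ (+ (p ℕ.^ 5 ℕ.* N ℕ.^ 4 ℕ.+ p ℕ.^ 6 ℕ.* N ℕ.^ 3))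
  R-bound zero    N       p-prime _ _ = ⊥-elim (ℕ.≢-nonZero⁻¹ 0 {{prime⇒nonZero p-prime}} refl)
  R-bound (suc m) (suc b) _       _ _ =
    subst (λ T → R (suc m) (suc b) ℚ.≤ (+ 10 ℚ./ 9) ℚ.* toℚ T) (sym (bound-cast (suc m) (suc b))) (R≤bound m b)
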